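{- Let $n,k,q$ be integers with $1 \leq k \leq \lfloor n/2 \rfloor - 1$ and $1 \leq q \leq n-1$. Let $f(n,k,q)$ denote the maximal number of edges in an $I_{k+1}$-free convex geometric graph on $n$ vertices that admits a free boundary arc of order $q$. Then: (1) If $q \leq n-2k$, then $f(n,k,q) = kn$; in particular, there exists an $I_{k+1}$-free convex geometric graph on $n$ vertices with exactly $kn$ edges that admits a free boundary arc of order $q$. (2) If $q = n-2k+\ell$ with $0 < \ell < k$, then $f(n,k,q) = kn - \binom{\ell+1}{2}$. (3) If $q \geq n-k$, then $f(n,k,q) = \binom{n}{2} - \binom{q}{2}$.
   Context: A geometric graph is a graph whose vertices are points in general position in the plane and whose edges are straight segments joining pairs of vertices. It is a convex geometric graph (CGG) if its vertices are in convex position (no vertex lies in the convex hull of the others). A geometric graph is $I_{k+1}$-free if it does not contain $k+1$ pairwise disjoint edges (edges as closed segments, so disjoint edges share no point, in particular no endpoint). For a CGG $G$, a set $A \subset V(G)$ is a free boundary arc of order $q$ if $A$ consists of $q$ consecutive vertices on the boundary of $\mathrm{conv}(V(G))$ and $A$ is independent, i.e., no edge of $G$ joins two vertices of $A$. -}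

module Defs where

open import Data.Nat using (ℕ; _+_; _*_; _∸_; _≤_; _<_; _≤ᵇ_; _<ᵇ_)
open import Data.Bool using (Bool; true; false; if_then_else_; _∧_)
open import Data.Fin using (Fin; toℕ)
open import Data.List using (List; map; allFin; length)
open import Data.Nat.ListAction using (sum)
open import Data.Sum using (_⊎_)
open import Data.List.Relation.Unary.AllPairs using (AllPairs)
open import Data.Product using (Σ; ∃; _×_; _,_)
open import Relation.Binary.PropositionalEquality using (_≡_; _≢_)
open import Relation.Nullary using (¬_)

-- Combinatorial model of a convex geometric graph on n vertices:
-- the vertices are labelled 0,…,n-1 in their cyclic order along the
-- boundary of the convex hull.  Only the entries G i j with i < j
-- are used: {i,j} (i < j) is an edge iff G i j ≡ true.
CGG : ℕ → Set
CGG n = Fin n → Fin n → Bool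

IsEdge : ∀ {n} → CGG n → Fin n → Fin n → Set
IsEdge G i j = (toℕ i < toℕ j) × (G i j ≡ true)

Edge : ∀ {n} → CGG n → Set
Edge {n} G = Σ (Fin n × Fin n) λ { (i , j) → IsEdge G i j }

edgeCount : ∀ {n} → CGG n → ℕ
edgeCount {n} G =
  sum (map (λ i → sum (map (λ j → if (toℕ i <ᵇ toℕ j) ∧ G i j then 1 else 0)
                           (allFin n)))
           (allFin n))

-- Two chords ab (a<b) and cd (c<d) of a convex polygon cross in their
-- relative interiors iff their endpoints interleave along the boundary.
Crossing : ∀ {n} → Fin n → Fin n → Fin n → Fin n → Set
Crossing a b c d =
  ((toℕ a < toℕ c) × (toℕ c < toℕ b) × (toℕ b < toℕ d)) ⊎
  ((toℕ c < toℕ a) × (toℕ a < toℕ d) × (toℕ d < toℕ b))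

Disjoint : ∀ {n} {G : CGG n} → Edge G → Edge G → Set
Disjoint ((a , b) , _) ((c , d) , _) =
  (a ≢ c) × (a ≢ d) × (b ≢ c) × (b ≢ d) × ¬ Crossing a b c d

IFree : ∀ {n} → ℕ → CGG n → Set
IFree {n} k G = (M : List (Edge G)) → AllPairs Disjoint M → length M ≤ k

offset : ∀ {n} → Fin n → Fin n → ℕ
offset {n} s v = if toℕ s ≤ᵇ toℕ v then toℕ v ∸ toℕ s else toℕ v + n ∸ toℕ s

InArc : ∀ {n} → Fin n → ℕ → Fin n → Set
InArc s q v = offset s v < q

HasFreeArc : ∀ {n} → CGG n → ℕ → Set
HasFreeArc {n} G q =
  ∃ λ (s : Fin n) → ∀ i j → InArc s q i → InArc s q j → ¬ IsEdge G i j

IsF : ℕ → ℕ → ℕ → ℕ → Set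
IsF n k q m =
  (∃ λ (G : CGG n) → IFree k G × HasFreeArc G q × edgeCount G ≡ m)
  × (∀ (G : CGG n) → IFree k G → HasFreeArc G q → edgeCount G ≤ m)

{-# OPTIONS --safe #-}
module Submission where

-- Label the vertices by their offset from the start s of the free arc, so that the
-- arc is 0, …, q − 1, and split the edges into n classes by the sum of their endpoints modulo n
-- (Kupitz): two distinct edges of one class are disjoint, so a class has at most k edges, which
-- gives kn.  The edges of a class σ that leave the arc have their outer ends in a window of t
-- vertices fixed by σ and q, so the class has at most ((n − q) + t)/2 edges; summing these bounds
-- over the classes next to the arc saves (ℓ+1 choose 2) when q = n − 2k + ℓ.  When q ≥ n − k it
-- suffices that every edge is a pair of vertices not both in the arc.
--
-- For (1) and (2), with d = k − ℓ, join the outer vertex q + p to every earlier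
-- vertex when p is odd or p ≥ 2d, and otherwise only to the outer vertices and to 0, …, ℓ.  A
-- matching of this graph is controlled by its edge from the middle of the arc with leftmost arc
-- end: all other edges lie inside it or after it, and the inside is handled by induction on the
-- window it spans.  For (3) take every edge leaving the arc: disjoint edges have distinct outer
-- ends, so there are at most n − q ≤ k of them.

open import Defs
open import Data.Nat
  using (ℕ; zero; suc; _+_; _*_; _∸_; _⊔_; _⊓_; _≤_; _<_; z≤n; s≤s; z<s; s<s; s≤s⁻¹; s<s⁻¹;
         _≤?_; _<?_; _≟_; ⌊_/2⌋; ⌈_/2⌉; parity)
open import Data.Nat.Properties
open import Data.Nat.Combinatorics using (_C_; nC1≡n; nCk+nC[k+1]≡[n+1]C[k+1])
open import Data.Nat.Induction using (<-wellFounded)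
open import Data.Nat.ListAction using (sum)
open import Data.Nat.ListAction.Properties using (sum-++)
open import Data.Nat.Tactic.RingSolver using (solve-∀)
open import Data.Parity.Base using (0ℙ; 1ℙ)
import Data.Parity.Properties as ℙ
open import Data.Bool using (true; false; if_then_else_)
open import Data.Bool.Properties using (T-≡)
open import Data.Fin using (Fin; toℕ; zero)
open import Data.Fin.Properties using (toℕ<n; toℕ-injective)
open import Data.Product using (_×_; ∃; ∃₂; _,_; proj₁; proj₂)
open import Data.Sum using (_⊎_; inj₁; inj₂)
open import Data.Empty using (⊥-elim)
open import Data.List using (List; []; _∷_; _++_; length; filter; map; concatMap; allFin; tabulate; cartesianProduct)
open import Data.List.Properties
  using (length-++; length-map; map-++; map-∘; map-tabulate; filter-all; filter-accept; filter-reject)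
open import Data.List.Relation.Unary.All as All using (All; []; _∷_)
import Data.List.Relation.Unary.All.Properties as All
open import Data.List.Relation.Unary.AllPairs as AllPairs using (AllPairs; []; _∷_)
import Data.List.Relation.Unary.AllPairs.Properties as AllPairs
open import Data.List.Relation.Unary.Unique.Propositional using (Unique)
import Data.List.Relation.Unary.Unique.Propositional.Properties as Unique
open import Data.List.Relation.Binary.Permutation.Propositional as ↭ using (_↭_; ↭-sym; ↭⇒↭ₛ)
open import Data.List.Relation.Binary.Permutation.Propositional.Properties using (All-resp-↭; ↭-length)
import Data.List.Relation.Binary.Permutation.Setoid.Properties as ↭ₛ
open import Function using (_∘_; _on_)
open import Function.Bundles using (Equivalence)
open import Induction.WellFounded using (Acc; acc)
open import Level using (0ℓ)
open import Relation.Nullary using (¬_; Dec; yes; no; does; contradiction; _×-dec_; _⊎-dec_; T?)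
open import Relation.Nullary.Decidable using (map′; dec-true; dec-false)
open import Relation.Binary.Core using (Rel)
open import Relation.Binary.Definitions using (Symmetric; tri<; tri≈; tri>)
open import Relation.Binary.PropositionalEquality
  using (_≡_; _≢_; refl; sym; trans; cong; cong₂; subst; subst₂; module ≡-Reasoning)
import Relation.Binary.PropositionalEquality as ≡
open import Relation.Unary using (Pred; Decidable; ∁)
open import Relation.Unary.Properties using (∁?)

2*m≤1+2*n⇒m≤n : ∀ {m n} → 2 * m ≤ suc (2 * n) → m ≤ n
2*m≤1+2*n⇒m≤n {m} {n} h with m ≤? n
... | yes m≤n = m≤n
... | no  m≰n = contradiction (≤-trans (≤-trans (≤-reflexive (sym (*-suc 2 n))) (*-monoʳ-≤ 2 (≰⇒> m≰n))) h)
                              (n≮n _)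

pair-half : ∀ {x y a} → 2 * x ≤ a → 2 * y ≤ suc a → x + y ≤ a
pair-half {x} {y} {a} 2x≤a 2y≤1+a = 2*m≤1+2*n⇒m≤n (begin
  2 * (x + y)       ≡⟨ *-distribˡ-+ 2 x y ⟩
  2 * x + 2 * y     ≤⟨ +-mono-≤ 2x≤a 2y≤1+a ⟩
  a + suc a         ≡⟨ a+[1+a]≡1+2a a ⟩
  suc (2 * a)       ∎)
  where
  open ≤-Reasoning
  a+[1+a]≡1+2a : ∀ a → a + suc a ≡ suc (2 * a)
  a+[1+a]≡1+2a = solve-∀

m+n≡o⇒m≡o∸n : ∀ {m n o} → m + n ≡ o → m ≡ o ∸ n
m+n≡o⇒m≡o∸n {m} {n} eq = trans (sym (m+n∸n≡m m n)) (cong (_∸ n) eq)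

window-bound : ∀ {m L q s p} → m ≤ L + ((q + s) ∸ suc (q + p)) → p < s → m + suc p ≤ L + s
window-bound {m} {L} {q} {s} {p} h p<s = begin
  m + suc p                             ≤⟨ +-monoˡ-≤ (suc p) h ⟩
  L + ((q + s) ∸ suc (q + p)) + suc p   ≡⟨ cong (λ z → L + (q + s ∸ z) + suc p) (sym (+-suc q p)) ⟩
  L + ((q + s) ∸ (q + suc p)) + suc p   ≡⟨ cong (λ z → L + z + suc p) ([m+n]∸[m+o]≡n∸o q s (suc p)) ⟩
  L + (s ∸ suc p) + suc p               ≡⟨ +-assoc L _ _ ⟩
  L + (s ∸ suc p + suc p)               ≡⟨ cong (L +_) (m∸n+n≡m p<s) ⟩
  L + s                                 ∎
  where open ≤-Reasoning

parity≡1ℙ⇒odd : ∀ n → parity n ≡ 1ℙ → ∃ λ r → n ≡ suc (2 * r)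
parity≡1ℙ⇒odd 1             _   = 0 , refl
parity≡1ℙ⇒odd (suc (suc n)) odd with parity≡1ℙ⇒odd n odd
... | r , refl = suc r , 3+2r≡1+2[1+r] r
  where
  3+2r≡1+2[1+r] : ∀ r → suc (suc (suc (2 * r))) ≡ suc (2 * suc r)
  3+2r≡1+2[1+r] = solve-∀

parity[2*n]≡0ℙ : ∀ n → parity (2 * n) ≡ 0ℙ
parity[2*n]≡0ℙ zero    = refl
parity[2*n]≡0ℙ (suc n) = trans (cong parity (*-suc 2 n)) (parity[2*n]≡0ℙ n)

parity[1+2*n]≡1ℙ : ∀ n → parity (suc (2 * n)) ≡ 1ℙ
parity[1+2*n]≡1ℙ zero    = refl
parity[1+2*n]≡1ℙ (suc n) = trans (cong (parity ∘ suc) (*-suc 2 n)) (parity[1+2*n]≡1ℙ n)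

∑< : ℕ → (ℕ → ℕ) → ℕ
∑< zero    f = 0
∑< (suc n) f = f 0 + ∑< n (f ∘ suc)

syntax ∑< n (λ i → e) = ∑[ i < n ] e

module _ where
  open ≡-Reasoning

  ∑<-cong : ∀ n {f g : ℕ → ℕ} → (∀ i → i < n → f i ≡ g i) → ∑< n f ≡ ∑< n g
  ∑<-cong zero    f≡g = refl
  ∑<-cong (suc n) f≡g = cong₂ _+_ (f≡g 0 z<s) (∑<-cong n (λ i i<n → f≡g (suc i) (s<s i<n)))

  ∑<-mono-≤ : ∀ n {f g : ℕ → ℕ} → (∀ i → i < n → f i ≤ g i) → ∑< n f ≤ ∑< n g
  ∑<-mono-≤ zero    f≤g = z≤n
  ∑<-mono-≤ (suc n) f≤g = +-mono-≤ (f≤g 0 z<s) (∑<-mono-≤ n (λ i i<n → f≤g (suc i) (s<s i<n)))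

  ∑<-const : ∀ n c → ∑[ i < n ] c ≡ n * c
  ∑<-const zero    c = refl
  ∑<-const (suc n) c = cong (c +_) (∑<-const n c)

  ∑<-zero : ∀ n {f : ℕ → ℕ} → (∀ i → i < n → f i ≡ 0) → ∑< n f ≡ 0
  ∑<-zero n f≡0 = trans (∑<-cong n f≡0) (trans (∑<-const n 0) (*-zeroʳ n))

  ∑<-ones : ∀ n {f : ℕ → ℕ} → (∀ i → i < n → f i ≡ 1) → ∑< n f ≡ n
  ∑<-ones n f≡1 = trans (∑<-cong n f≡1) (trans (∑<-const n 1) (*-identityʳ n))

  ∑<-distrib-+ : ∀ n (f g : ℕ → ℕ) → ∑[ i < n ] (f i + g i) ≡ ∑< n f + ∑< n g
  ∑<-distrib-+ zero    f g = refl
  ∑<-distrib-+ (suc n) f g = begin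
    f 0 + g 0 + ∑[ i < n ] (f (suc i) + g (suc i))
      ≡⟨ cong (f 0 + g 0 +_) (∑<-distrib-+ n (f ∘ suc) (g ∘ suc)) ⟩
    f 0 + g 0 + (∑< n (f ∘ suc) + ∑< n (g ∘ suc))
      ≡⟨ +-+-comm (f 0) (g 0) _ _ ⟩
    f 0 + ∑< n (f ∘ suc) + (g 0 + ∑< n (g ∘ suc)) ∎
    where
    +-+-comm : ∀ a b c d → a + b + (c + d) ≡ a + c + (b + d)
    +-+-comm = solve-∀

  ∑<-*ˡ : ∀ n c (f : ℕ → ℕ) → ∑[ i < n ] (c * f i) ≡ c * ∑< n f
  ∑<-*ˡ zero    c f = sym (*-zeroʳ c)
  ∑<-*ˡ (suc n) c f = trans (cong (c * f 0 +_) (∑<-*ˡ n c (f ∘ suc))) (sym (*-distribˡ-+ c (f 0) _))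

  ∑<-+ : ∀ m n (f : ℕ → ℕ) → ∑< (m + n) f ≡ ∑< m f + ∑[ i < n ] f (m + i)
  ∑<-+ zero    n f = refl
  ∑<-+ (suc m) n f = trans (cong (f 0 +_) (∑<-+ m n (f ∘ suc))) (sym (+-assoc (f 0) _ _))

  ∑<-suc : ∀ n (f : ℕ → ℕ) → ∑< (suc n) f ≡ ∑< n f + f n
  ∑<-suc n f = begin
    ∑< (suc n) f            ≡⟨ cong (λ m → ∑< m f) (+-comm 1 n) ⟩
    ∑< (n + 1) f            ≡⟨ ∑<-+ n 1 f ⟩
    ∑< n f + (f (n + 0) + 0) ≡⟨ cong (∑< n f +_) (trans (+-identityʳ _) (cong f (+-identityʳ n))) ⟩
    ∑< n f + f n            ∎

  ∑<-reverse : ∀ n (f : ℕ → ℕ) → ∑< n f ≡ ∑[ i < n ] f (n ∸ suc i)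
  ∑<-reverse zero    f = refl
  ∑<-reverse (suc n) f = begin
    ∑< (suc n) f                      ≡⟨ ∑<-suc n f ⟩
    ∑< n f + f n                      ≡⟨ cong (_+ f n) (∑<-reverse n f) ⟩
    ∑[ i < n ] f (n ∸ suc i) + f n    ≡⟨ +-comm _ (f n) ⟩
    f n + ∑[ i < n ] f (n ∸ suc i)    ∎

  ∑<-pairs : ∀ n (f : ℕ → ℕ) → ∑< (2 * n) f ≡ ∑[ i < n ] (f (2 * i) + f (suc (2 * i)))
  ∑<-pairs zero    f = refl
  ∑<-pairs (suc n) f = begin
    ∑< (2 * suc n) f
      ≡⟨ cong (λ m → ∑< m f) (*-suc 2 n) ⟩
    f 0 + (f 1 + ∑< (2 * n) (f ∘ suc ∘ suc))
      ≡⟨ cong (λ s → f 0 + (f 1 + s)) (∑<-pairs n (f ∘ suc ∘ suc)) ⟩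
    f 0 + (f 1 + ∑[ i < n ] (f (2 + 2 * i) + f (3 + 2 * i)))
      ≡⟨ sym (+-assoc (f 0) (f 1) _) ⟩
    f 0 + f 1 + ∑[ i < n ] (f (2 + 2 * i) + f (3 + 2 * i))
      ≡⟨ cong (f 0 + f 1 +_) (∑<-cong n (λ i _ → cong₂ (λ a b → f a + f b)
           (sym (*-suc 2 i)) (cong suc (sym (*-suc 2 i))))) ⟩
    f 0 + f 1 + ∑[ i < n ] (f (2 * suc i) + f (suc (2 * suc i))) ∎

triangular : ℕ → ℕ
triangular zero    = 0
triangular (suc n) = n + triangular n

module _ where
  open ≡-Reasoning

  triangular≡C2 : ∀ n → triangular n ≡ n C 2
  triangular≡C2 zero    = refl
  triangular≡C2 (suc n) =
    trans (cong₂ _+_ (sym (nC1≡n n)) (triangular≡C2 n)) (nCk+nC[k+1]≡[n+1]C[k+1] n 1)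

  triangular-double : ∀ n → 2 * triangular n + n ≡ n * n
  triangular-double zero    = refl
  triangular-double (suc n) = begin
    2 * (n + triangular n) + suc n       ≡⟨ regroup n (triangular n) ⟩
    2 * triangular n + n + suc (2 * n)   ≡⟨ cong (_+ suc (2 * n)) (triangular-double n) ⟩
    n * n + suc (2 * n)                  ≡⟨ square-suc n ⟩
    suc n * suc n                        ∎
    where
    regroup : ∀ n t → 2 * (n + t) + suc n ≡ 2 * t + n + suc (2 * n)
    regroup = solve-∀
    square-suc : ∀ n → n * n + suc (2 * n) ≡ suc n * suc n
    square-suc = solve-∀

  triangular-mono-≤ : ∀ {m n} → m ≤ n → triangular m ≤ triangular n
  triangular-mono-≤ {zero}      _         = z≤n
  triangular-mono-≤ {suc m} (s≤s m≤n) = +-mono-≤ m≤n (triangular-mono-≤ m≤n)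

  ∑<-id : ∀ n → ∑[ i < n ] i ≡ triangular n
  ∑<-id zero    = refl
  ∑<-id (suc n) = begin
    ∑[ i < n ] suc i          ≡⟨ ∑<-distrib-+ n (λ _ → 1) (λ i → i) ⟩
    ∑[ i < n ] 1 + ∑[ i < n ] i ≡⟨ cong₂ _+_ (trans (∑<-const n 1) (*-identityʳ n)) (∑<-id n) ⟩
    n + triangular n          ∎

  ∑<-affine : ∀ n c → ∑[ i < n ] (c + i) ≡ n * c + triangular n
  ∑<-affine n c = trans (∑<-distrib-+ n (λ _ → c) (λ i → i)) (cong₂ _+_ (∑<-const n c) (∑<-id n))

  triangular-+ : ∀ m n → triangular (m + n) ≡ triangular m + (n * m + triangular n)
  triangular-+ m n = begin
    triangular (m + n)              ≡⟨ sym (∑<-id (m + n)) ⟩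
    ∑[ i < m + n ] i                ≡⟨ ∑<-+ m n (λ i → i) ⟩
    ∑[ i < m ] i + ∑[ i < n ] (m + i) ≡⟨ cong₂ _+_ (∑<-id m) (∑<-affine n m) ⟩
    triangular m + (n * m + triangular n) ∎

triangular[1+ℓ]≡[ℓ+1]C2 : ∀ ℓ → triangular (suc ℓ) ≡ (ℓ + 1) C 2
triangular[1+ℓ]≡[ℓ+1]C2 ℓ = trans (triangular≡C2 (suc ℓ)) (cong (_C 2) (+-comm 1 ℓ))

⟦_⟧ : ∀ {A : Set} → Dec A → ℕ
⟦ a? ⟧ = if does a? then 1 else 0

⟦⟧-yes : ∀ {A : Set} (a? : Dec A) → A → ⟦ a? ⟧ ≡ 1
⟦⟧-yes a? a rewrite dec-true a? a = refl

⟦⟧-no : ∀ {A : Set} (a? : Dec A) → ¬ A → ⟦ a? ⟧ ≡ 0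
⟦⟧-no a? ¬a rewrite dec-false a? ¬a = refl

⟦⟧-×-yes : ∀ {A B : Set} (a? : Dec A) (b? : Dec B) → A → ⟦ a? ×-dec b? ⟧ ≡ ⟦ b? ⟧
⟦⟧-×-yes a? b? a rewrite dec-true a? a = refl

does≡true⇒ : ∀ {A : Set} (a? : Dec A) → does a? ≡ true → A
does≡true⇒ (yes a) _ = a

true? : ∀ b → Dec (b ≡ true)
true? b = map′ (Equivalence.to T-≡) (Equivalence.from T-≡) (T? b)

module _ {A : Set} {P : Pred A 0ℓ} (P? : Decidable P) where

  length-filter+filter-∁ : ∀ xs → length xs ≡ length (filter P? xs) + length (filter (∁? P?) xs)
  length-filter+filter-∁ []       = refl
  length-filter+filter-∁ (x ∷ xs) with P? x
  ... | yes _ = cong suc (length-filter+filter-∁ xs)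
  ... | no  _ = trans (cong suc (length-filter+filter-∁ xs)) (sym (+-suc _ _))

  length-filter : ∀ xs → length (filter P? xs) ≡ sum (map (λ x → ⟦ P? x ⟧) xs)
  length-filter []       = refl
  length-filter (x ∷ xs) with P? x
  ... | yes _ = cong suc (length-filter xs)
  ... | no  _ = length-filter xs

  length-filter-∷ : ∀ x xs → length (filter P? (x ∷ xs)) ≡ ⟦ P? x ⟧ + length (filter P? xs)
  length-filter-∷ x xs with P? x
  ... | yes _ = refl
  ... | no  _ = refl

map-proj₁-toList : ∀ {A : Set} {P : Pred A 0ℓ} {xs} (pxs : All P xs) → map proj₁ (All.toList pxs) ≡ xs
map-proj₁-toList []         = refl
map-proj₁-toList (_ ∷ pxs) = cong (_ ∷_) (map-proj₁-toList pxs)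

sum-cartesianProduct : ∀ {A B : Set} (f : A × B → ℕ) xs ys →
  sum (map f (cartesianProduct xs ys)) ≡ sum (map (λ x → sum (map (λ y → f (x , y)) ys)) xs)
sum-cartesianProduct f []       ys = refl
sum-cartesianProduct f (x ∷ xs) ys = begin
  sum (map f (map (x ,_) ys ++ cartesianProduct xs ys))
    ≡⟨ cong sum (map-++ f (map (x ,_) ys) _) ⟩
  sum (map f (map (x ,_) ys) ++ map f (cartesianProduct xs ys))
    ≡⟨ sum-++ (map f (map (x ,_) ys)) _ ⟩
  sum (map f (map (x ,_) ys)) + sum (map f (cartesianProduct xs ys))
    ≡⟨ cong₂ _+_ (cong sum (sym (map-∘ ys))) (sum-cartesianProduct f xs ys) ⟩
  sum (map (λ y → f (x , y)) ys) + sum (map (λ x → sum (map (λ y → f (x , y)) ys)) xs) ∎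
  where open ≡-Reasoning

sum-map-allFin : ∀ n (f : ℕ → ℕ) → sum (map (f ∘ toℕ) (allFin n)) ≡ ∑< n f
sum-map-allFin n f = trans (cong sum (map-tabulate {n = n} (λ i → i) (f ∘ toℕ))) (sum-tabulate n f)
  where
  sum-tabulate : ∀ n (f : ℕ → ℕ) → sum (tabulate {n = n} (f ∘ toℕ)) ≡ ∑< n f
  sum-tabulate zero    f = refl
  sum-tabulate (suc n) f = cong (f 0 +_) (sum-tabulate n (f ∘ suc))

length-concatMap-pair : ∀ {A B : Set} (f g : A → List B) xs → All (λ x → length (f x) + length (g x) ≡ 2) xs →
  length (concatMap f xs) + length (concatMap g xs) ≡ 2 * length xs
length-concatMap-pair f g []       []         = refl
length-concatMap-pair f g (x ∷ xs) (fx+gx≡2 ∷ rest) = begin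
  length (f x ++ concatMap f xs) + length (g x ++ concatMap g xs)
    ≡⟨ cong₂ _+_ (length-++ (f x)) (length-++ (g x)) ⟩
  (length (f x) + length (concatMap f xs)) + (length (g x) + length (concatMap g xs))
    ≡⟨ +-+-comm (length (f x)) _ _ _ ⟩
  (length (f x) + length (g x)) + (length (concatMap f xs) + length (concatMap g xs))
    ≡⟨ cong₂ _+_ fx+gx≡2 (length-concatMap-pair f g xs rest) ⟩
  2 + 2 * length xs
    ≡⟨ *-suc 2 (length xs) ⟨
  2 * suc (length xs) ∎
  where
  open ≡-Reasoning
  +-+-comm : ∀ a b c d → (a + b) + (c + d) ≡ (a + c) + (b + d)
  +-+-comm = solve-∀

∑-⟦≟⟧ : ∀ {n v} → v < n → ∑[ σ < n ] ⟦ v ≟ σ ⟧ ≡ 1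
∑-⟦≟⟧ {suc n} {zero}  _       = cong suc (∑<-zero n (λ _ _ → refl))
∑-⟦≟⟧ {suc n} {suc v} 1+v<1+n = ∑-⟦≟⟧ (s<s⁻¹ 1+v<1+n)

length≡∑-classes : ∀ {A : Set} n (κ : A → ℕ) xs → All (λ x → κ x < n) xs →
  length xs ≡ ∑[ σ < n ] length (filter (λ x → κ x ≟ σ) xs)
length≡∑-classes n κ []       []          = sym (∑<-zero n (λ _ _ → refl))
length≡∑-classes n κ (x ∷ xs) (κx<n ∷ κxs<n) = begin
  suc (length xs)
    ≡⟨ cong₂ _+_ (sym (∑-⟦≟⟧ κx<n)) (length≡∑-classes n κ xs κxs<n) ⟩
  ∑[ σ < n ] ⟦ κ x ≟ σ ⟧ + ∑[ σ < n ] length (filter (λ y → κ y ≟ σ) xs)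
    ≡⟨ ∑<-distrib-+ n _ _ ⟨
  ∑[ σ < n ] (⟦ κ x ≟ σ ⟧ + length (filter (λ y → κ y ≟ σ) xs))
    ≡⟨ ∑<-cong n (λ σ _ → length-filter-∷ (λ y → κ y ≟ σ) x xs) ⟨
  ∑[ σ < n ] length (filter (λ y → κ y ≟ σ) (x ∷ xs)) ∎
  where open ≡-Reasoning

AllPairs-resp-↭ : ∀ {A : Set} {R : Rel A 0ℓ} → Symmetric R → ∀ {xs ys} → xs ↭ ys → AllPairs R xs → AllPairs R ys
AllPairs-resp-↭ {A} {R} R-sym p = ↭ₛ.AllPairs-resp-↭ (≡.setoid A) R-sym (≡.resp₂ R) (↭⇒↭ₛ p)

AllPairs-restrict : ∀ {A : Set} {P : Pred A 0ℓ} {R S : Rel A 0ℓ} → (∀ {x y} → P x → P y → R x y → S x y) →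
  ∀ {xs} → All P xs → AllPairs R xs → AllPairs S xs
AllPairs-restrict R⇒S []         []           = []
AllPairs-restrict R⇒S (px ∷ pxs) (rx ∷ rxs) =
  All.zipWith (λ (py , r) → R⇒S px py r) (pxs , rx) ∷ AllPairs-restrict R⇒S pxs rxs

module _ {A : Set} (key : A → ℕ) {P : Pred A 0ℓ} (P? : Decidable P) where

  extract-min : ∀ xs → All (∁ P) xs ⊎
    ∃₂ λ x rest → xs ↭ x ∷ rest × P x × All (λ y → P y → key x ≤ key y) rest
  extract-min []       = inj₁ []
  extract-min (x ∷ xs) with extract-min xs | P? x
  ... | inj₁ none | no ¬px = inj₁ (¬px ∷ none)
  ... | inj₁ none | yes px = inj₂ (x , xs , ↭.refl , px , All.map (λ ¬py py → contradiction py ¬py) none)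
  ... | inj₂ (m , rest , xs↭ , pm , m-min) | no ¬px =
    inj₂ (m , x ∷ rest , ↭.trans (↭.prep x xs↭) (↭.swap x m ↭.refl) , pm , (λ px → contradiction px ¬px) ∷ m-min)
  ... | inj₂ (m , rest , xs↭ , pm , m-min) | yes px with key x <? key m
  ...   | yes x<m = inj₂ (x , xs , ↭.refl , px ,
            All-resp-↭ (↭-sym xs↭) ((λ _ → <⇒≤ x<m) ∷ All.map (λ m≤y py → ≤-trans (<⇒≤ x<m) (m≤y py)) m-min))
  ...   | no  x≮m = inj₂ (m , x ∷ rest , ↭.trans (↭.prep x xs↭) (↭.swap x m ↭.refl) , pm , (λ _ → ≮⇒≥ x≮m) ∷ m-min)

length≤1+length-filter-< : ∀ {h} xs → Unique xs → All (_≤ h) xs →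
  length xs ≤ suc (length (filter (_<? h) xs))
length≤1+length-filter-< []       _            _           = z≤n
length≤1+length-filter-< {h} (x ∷ xs) (x∉xs ∷ xs!) (x≤h ∷ xs≤h) with x <? h
... | yes x<h = begin
  suc (length xs)                          ≤⟨ s≤s (length≤1+length-filter-< xs xs! xs≤h) ⟩
  suc (length (x ∷ filter (_<? h) xs))     ≡⟨ cong (suc ∘ length) (filter-accept (_<? h) x<h) ⟨
  suc (length (filter (_<? h) (x ∷ xs)))   ∎
  where open ≤-Reasoning
... | no  x≮h = begin
  suc (length xs)                          ≡⟨ cong (suc ∘ length) (filter-all (_<? h) xs<h) ⟨
  suc (length (filter (_<? h) xs))         ≡⟨ cong (suc ∘ length) (filter-reject (_<? h) x≮h) ⟨
  suc (length (filter (_<? h) (x ∷ xs)))   ∎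
  where
  open ≤-Reasoning
  xs<h : All (_< h) xs
  xs<h = All.zipWith (λ (y≤h , x≢y) → ≤∧≢⇒< y≤h (λ y≡h → x≢y (trans (≤-antisym x≤h (≮⇒≥ x≮h)) (sym y≡h))))
           (xs≤h , x∉xs)

Within : ℕ → ℕ → ℕ → Set
Within lo hi x = lo ≤ x × x < hi

unique-within-length : ∀ lo hi xs → Unique xs → All (Within lo hi) xs → length xs ≤ hi ∸ lo
unique-within-length lo zero    []      _ _               = z≤n
unique-within-length lo zero    (_ ∷ _) _ ((_ , ()) ∷ _)
unique-within-length lo (suc h) xs      xs! xs⊆ with lo ≤? h
... | yes lo≤h = begin
  length xs                          ≤⟨ length≤1+length-filter-< xs xs! (All.map (s≤s⁻¹ ∘ proj₂) xs⊆) ⟩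
  suc (length (filter (_<? h) xs))   ≤⟨ s≤s (unique-within-length lo h _ (Unique.filter⁺ (_<? h) xs!) ys⊆) ⟩
  suc (h ∸ lo)                       ≡⟨ sym (+-∸-assoc 1 lo≤h) ⟩
  suc h ∸ lo                         ∎
  where
  open ≤-Reasoning
  ys⊆ : All (Within lo h) (filter (_<? h) xs)
  ys⊆ = All.zipWith (λ ((lo≤y , _) , y<h) → lo≤y , y<h) (All.filter⁺ (_<? h) xs⊆ , All.all-filter (_<? h) xs)
... | no lo≰h with xs | xs⊆
...   | []    | _                 = z≤n
...   | _ ∷ _ | (lo≤x , x<h) ∷ _ = contradiction (≤-trans lo≤x (s≤s⁻¹ x<h)) lo≰h

unique-within₂-length : ∀ L lo hi xs → Unique xs → All (λ x → x < L ⊎ Within lo hi x) xs →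
  length xs ≤ L + (hi ∸ lo)
unique-within₂-length L lo hi xs xs! xs⊆ = begin
  length xs                                             ≡⟨ length-filter+filter-∁ (_<? L) xs ⟩
  length (filter (_<? L) xs) + length (filter (∁? (_<? L)) xs)
    ≤⟨ +-mono-≤ (unique-within-length 0 L _ (Unique.filter⁺ (_<? L) xs!)
                   (All.map (z≤n ,_) (All.all-filter (_<? L) xs)))
                (unique-within-length lo hi _ (Unique.filter⁺ (∁? (_<? L)) xs!)
                   (All.zipWith high (All.filter⁺ (∁? (_<? L)) xs⊆ , All.all-filter (∁? (_<? L)) xs))) ⟩
  L + (hi ∸ lo)                                         ∎
  where
  open ≤-Reasoning
  high : ∀ {x} → (x < L ⊎ Within lo hi x) × ¬ x < L → Within lo hi x
  high (inj₁ x<L , x≮L) = contradiction x<L x≮L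
  high (inj₂ x∈ , _)   = x∈

Chord : Set
Chord = ℕ × ℕ

Crosses : Chord → Chord → Set
Crosses (a , b) (c , d) = (a < c × c < b × b < d) ⊎ (c < a × a < d × d < b)

NoCommonEndpoint : Chord → Chord → Set
NoCommonEndpoint (a , b) (c , d) = a ≢ c × a ≢ d × b ≢ c × b ≢ d

DisjointChords : Chord → Chord → Set
DisjointChords c d = NoCommonEndpoint c d × ¬ Crosses c d

Ascending : Chord → Set
Ascending (a , b) = a < b

Crosses-sym : ∀ {c d} → Crosses c d → Crosses d c
Crosses-sym (inj₁ x) = inj₂ x
Crosses-sym (inj₂ x) = inj₁ x

NoCommonEndpoint-sym : ∀ {c d} → NoCommonEndpoint c d → NoCommonEndpoint d c
NoCommonEndpoint-sym (a≢c , a≢d , b≢c , b≢d) = a≢c ∘ sym , b≢c ∘ sym , a≢d ∘ sym , b≢d ∘ sym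

DisjointChords-sym : ∀ {c d} → DisjointChords c d → DisjointChords d c
DisjointChords-sym (apart , ¬cross) = NoCommonEndpoint-sym apart , ¬cross ∘ Crosses-sym

data Position (a b c d : ℕ) : Set where
  inside   : a < c → d < b → Position a b c d
  left     : d < a → Position a b c d
  right    : b < c → Position a b c d
  around   : c < a → b < d → Position a b c d

disjoint-position : ∀ {a b c d} → c < d → DisjointChords (a , b) (c , d) → Position a b c d
disjoint-position {a} {b} {c} {d} c<d ((a≢c , a≢d , b≢c , b≢d) , ¬cross) with <-cmp c a
... | tri≈ _ c≡a _ = contradiction (sym c≡a) a≢c
... | tri< c<a _ _ with <-cmp d a
...   | tri< d<a _ _ = left d<a
...   | tri≈ _ d≡a _ = contradiction (sym d≡a) a≢d
...   | tri> _ _ a<d with <-cmp d b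
...     | tri< d<b _ _ = contradiction (inj₂ (c<a , a<d , d<b)) ¬cross
...     | tri≈ _ d≡b _ = contradiction (sym d≡b) b≢d
...     | tri> _ _ b<d = around c<a b<d
disjoint-position {a} {b} {c} {d} c<d ((a≢c , a≢d , b≢c , b≢d) , ¬cross) | tri> _ _ a<c with <-cmp c b
...   | tri≈ _ c≡b _ = contradiction (sym c≡b) b≢c
...   | tri> _ _ b<c = right b<c
...   | tri< c<b _ _ with <-cmp d b
...     | tri< d<b _ _ = inside a<c d<b
...     | tri≈ _ d≡b _ = contradiction (sym d≡b) b≢d
...     | tri> _ _ b<d = contradiction (inj₁ (a<c , c<b , b<d)) ¬cross

module _ (pick : Chord → List ℕ)
         (pick-endpoints : ∀ {P : ℕ → Set} c → P (proj₁ c) → P (proj₂ c) → All P (pick c))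
         (pick-unique : ∀ c → proj₁ c ≢ proj₂ c → Unique (pick c)) where

  picked-unique : ∀ {M} → AllPairs NoCommonEndpoint M → All (λ c → proj₁ c ≢ proj₂ c) M →
    Unique (concatMap pick M)
  picked-unique []                       []              = []
  picked-unique {c ∷ M} (c-apart ∷ M-apart) (c-loopless ∷ M-loopless) =
    AllPairs.++⁺ (pick-unique c c-loopless) (picked-unique M-apart M-loopless)
      (pick-endpoints c (others proj₁ (All.map (λ (a≢c , a≢d , _) → a≢c , a≢d) c-apart))
                        (others proj₂ (All.map (λ (_ , _ , b≢c , b≢d) → b≢c , b≢d) c-apart)))
    where
    others : ∀ (end : Chord → ℕ) {M} → All (λ d → end c ≢ proj₁ d × end c ≢ proj₂ d) M →
      All (end c ≢_) (concatMap pick M)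
    others end {[]}    [] = []
    others end {d ∷ M} (apart ∷ rest) = All.++⁺ (pick-endpoints d (proj₁ apart) (proj₂ apart)) (others end rest)

endpoints : List Chord → List ℕ
endpoints = concatMap (λ (a , b) → a ∷ b ∷ [])

length-endpoints : ∀ M → length (endpoints M) ≡ 2 * length M
length-endpoints []      = refl
length-endpoints (_ ∷ M) = trans (cong (2 +_) (length-endpoints M)) (sym (*-suc 2 (length M)))

endpoints-unique : ∀ {M} → AllPairs NoCommonEndpoint M → All Ascending M → Unique (endpoints M)
endpoints-unique apart ascending =
  picked-unique (λ (a , b) → a ∷ b ∷ []) (λ _ pa pb → pa ∷ pb ∷ []) (λ _ a≢b → (a≢b ∷ []) ∷ [] ∷ [])
    apart (All.map <⇒≢ ascending)

rights-unique : ∀ {M} → AllPairs DisjointChords M → Unique (map proj₂ M)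
rights-unique disjoint = AllPairs.map⁺ (AllPairs.map (λ ((_ , _ , _ , b≢d) , _) → b≢d) disjoint)

All-endpoints : ∀ {P : ℕ → Set} {M} → All (λ c → P (proj₁ c) × P (proj₂ c)) M → All P (endpoints M)
All-endpoints []               = []
All-endpoints ((pa , pb) ∷ ps) = pa ∷ pb ∷ All-endpoints ps

endpoints-pigeonhole : ∀ {P : ℕ → Set} {b M} → (∀ {xs} → Unique xs → All P xs → length xs ≤ b) →
  AllPairs DisjointChords M → All Ascending M → All (λ c → P (proj₁ c) × P (proj₂ c)) M → 2 * length M ≤ b
endpoints-pigeonhole {M = M} pigeonhole disjoint ascending ends = subst (_≤ _) (length-endpoints M)
  (pigeonhole (endpoints-unique (AllPairs.map proj₁ disjoint) ascending) (All-endpoints ends))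

module _ {n : ℕ} (G : CGG n) where

  isEdge? : (e : Fin n × Fin n) → Dec (IsEdge G (proj₁ e) (proj₂ e))
  isEdge? (i , j) = toℕ i <? toℕ j ×-dec true? (G i j)

  vertexPairs : List (Fin n × Fin n)
  vertexPairs = cartesianProduct (allFin n) (allFin n)

  edgePairs-are-edges : All (λ e → IsEdge G (proj₁ e) (proj₂ e)) (filter isEdge? vertexPairs)
  edgePairs-are-edges = All.all-filter isEdge? vertexPairs

  edges : List (Edge G)
  edges = All.toList edgePairs-are-edges

  edges-distinct : AllPairs (_≢_ on proj₁) edges
  edges-distinct = AllPairs.map⁻ (subst Unique (sym (map-proj₁-toList edgePairs-are-edges))
    (Unique.filter⁺ isEdge? (Unique.cartesianProduct⁺ (Unique.allFin⁺ n) (Unique.allFin⁺ n))))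

  length-edges : length edges ≡ edgeCount G
  length-edges = begin
    length edges                                    ≡⟨ length-map proj₁ edges ⟨
    length (map proj₁ edges)                        ≡⟨ cong length (map-proj₁-toList edgePairs-are-edges) ⟩
    length (filter isEdge? vertexPairs)             ≡⟨ length-filter isEdge? vertexPairs ⟩
    sum (map (λ e → ⟦ isEdge? e ⟧) vertexPairs)     ≡⟨ sum-cartesianProduct (λ e → ⟦ isEdge? e ⟧) (allFin n) (allFin n) ⟩
    edgeCount G                                     ∎
    where open ≡-Reasoning

chord : ∀ {n} {G : CGG n} → Edge G → Chord
chord ((i , j) , _) = toℕ i , toℕ j

chord-disjoint : ∀ {n} {G : CGG n} {e f : Edge G} → Disjoint e f → DisjointChords (chord e) (chord f)
chord-disjoint (a≢c , a≢d , b≢c , b≢d , ¬cross) =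
  (a≢c ∘ toℕ-injective , a≢d ∘ toℕ-injective , b≢c ∘ toℕ-injective , b≢d ∘ toℕ-injective) , ¬cross

chords-disjoint : ∀ {n} {G : CGG n} {M : List (Edge G)} → AllPairs Disjoint M → AllPairs DisjointChords (map chord M)
chords-disjoint disjoint = AllPairs.map⁺ (AllPairs.map (λ {e} {f} → chord-disjoint {e = e} {f = f}) disjoint)

chord-disjoint⁻ : ∀ {n} {G : CGG n} {e f : Edge G} → DisjointChords (chord e) (chord f) → Disjoint e f
chord-disjoint⁻ ((a≢c , a≢d , b≢c , b≢d) , ¬cross) =
  a≢c ∘ cong toℕ , a≢d ∘ cong toℕ , b≢c ∘ cong toℕ , b≢d ∘ cong toℕ , ¬cross

module _ {R : ℕ → ℕ → Set} (R? : ∀ x y → Dec (R x y)) where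

  cgg : (n : ℕ) → CGG n
  cgg n i j = does (R? (toℕ i) (toℕ j))

  ∑-upper-triangle : ∀ n → ∑[ x < n ] ∑[ y < n ] ⟦ x <? y ×-dec R? x y ⟧ ≡ ∑[ y < n ] ∑[ x < y ] ⟦ R? x y ⟧
  ∑-upper-triangle zero    = refl
  ∑-upper-triangle (suc n) = begin
    ∑[ x < suc n ] ∑[ y < suc n ] I x y
      ≡⟨ ∑<-cong (suc n) (λ x _ → ∑<-suc n (I x)) ⟩
    ∑[ x < suc n ] (∑[ y < n ] I x y + I x n)
      ≡⟨ ∑<-distrib-+ (suc n) (λ x → ∑[ y < n ] I x y) (λ x → I x n) ⟩
    ∑[ x < suc n ] ∑[ y < n ] I x y + ∑[ x < suc n ] I x n
      ≡⟨ cong₂ _+_ (∑<-suc n (λ x → ∑[ y < n ] I x y)) (∑<-suc n (λ x → I x n)) ⟩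
    (∑[ x < n ] ∑[ y < n ] I x y + ∑[ y < n ] I n y) + (∑[ x < n ] I x n + I n n)
      ≡⟨ cong₂ (λ a b → (∑[ x < n ] ∑[ y < n ] I x y + a) + (∑[ x < n ] I x n + b))
           (∑<-zero n (λ y y<n → ⟦⟧-no (n <? y ×-dec R? n y) (λ (n<y , _) → <-asym y<n n<y)))
           (⟦⟧-no (n <? n ×-dec R? n n) (λ (n<n , _) → n≮n n n<n)) ⟩
    (∑[ x < n ] ∑[ y < n ] I x y + 0) + (∑[ x < n ] I x n + 0)
      ≡⟨ cong₂ _+_ (trans (+-identityʳ _) (∑-upper-triangle n))
                   (trans (+-identityʳ _) (∑<-cong n (λ x x<n → ⟦⟧-×-yes (x <? n) (R? x n) x<n))) ⟩
    ∑[ y < n ] ∑[ x < y ] ⟦ R? x y ⟧ + ∑[ x < n ] ⟦ R? x n ⟧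
      ≡⟨ ∑<-suc n (λ y → ∑[ x < y ] ⟦ R? x y ⟧) ⟨
    ∑[ y < suc n ] ∑[ x < y ] ⟦ R? x y ⟧ ∎
    where
    open ≡-Reasoning
    I : ℕ → ℕ → ℕ
    I x y = ⟦ x <? y ×-dec R? x y ⟧

  edgeCount-cgg : ∀ n → edgeCount (cgg n) ≡ ∑[ y < n ] ∑[ x < y ] ⟦ R? x y ⟧
  edgeCount-cgg n =
    trans (trans (sum-map-allFin n _) (∑<-cong n (λ x _ → sum-map-allFin n _))) (∑-upper-triangle n)

  cgg-arc-free : ∀ {n q} → (∀ {x y} → y < q → ¬ R x y) → HasFreeArc (cgg (suc n)) q
  cgg-arc-free arc-free = zero , λ i j _ j<q (_ , Rij) → arc-free j<q (does≡true⇒ (R? _ _) Rij)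

-- The construction for (1) and (2)

construction-count : ∀ q ℓ d →
  ∑[ i < d ] ((suc ℓ + 2 * i) + (q + suc (2 * i))) + ∑[ i < ℓ ] (q + (2 * d + i)) + triangular (suc ℓ)
    ≡ (ℓ + d) * (q + (2 * d + ℓ))
construction-count q ℓ d = +-cancelʳ-≡ (2 * d) _ _ (begin
  ∑[ i < d ] ((suc ℓ + 2 * i) + (q + suc (2 * i))) + ∑[ i < ℓ ] (q + (2 * d + i)) + (ℓ + Tℓ) + 2 * d
    ≡⟨ cong₂ (λ a b → a + b + (ℓ + Tℓ) + 2 * d) pairs-sum tail-sum ⟩
  d * (2 + (ℓ + q)) + 4 * Td + (ℓ * (q + 2 * d) + Tℓ) + (ℓ + Tℓ) + 2 * d
    ≡⟨ regroup d ℓ q Td Tℓ ⟩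
  d * (2 + (ℓ + q)) + ℓ * (q + 2 * d) + 2 * (2 * Td + d) + (2 * Tℓ + ℓ)
    ≡⟨ cong₂ (λ a b → d * (2 + (ℓ + q)) + ℓ * (q + 2 * d) + 2 * a + b) (triangular-double d) (triangular-double ℓ) ⟩
  d * (2 + (ℓ + q)) + ℓ * (q + 2 * d) + 2 * (d * d) + ℓ * ℓ
    ≡⟨ expand d ℓ q ⟩
  (ℓ + d) * (q + (2 * d + ℓ)) + 2 * d ∎)
  where
  open ≡-Reasoning
  Td Tℓ : ℕ
  Td = triangular d
  Tℓ = triangular ℓ
  pairs-sum : ∑[ i < d ] ((suc ℓ + 2 * i) + (q + suc (2 * i))) ≡ d * (2 + (ℓ + q)) + 4 * Td
  pairs-sum = begin
    ∑[ i < d ] ((suc ℓ + 2 * i) + (q + suc (2 * i)))  ≡⟨ ∑<-cong d (λ i _ → e ℓ q i) ⟩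
    ∑[ i < d ] ((2 + (ℓ + q)) + 4 * i)               ≡⟨ ∑<-distrib-+ d (λ _ → 2 + (ℓ + q)) (4 *_) ⟩
    ∑[ i < d ] (2 + (ℓ + q)) + ∑[ i < d ] (4 * i)   ≡⟨ cong₂ _+_ (∑<-const d _) (trans (∑<-*ˡ d 4 (λ i → i)) (cong (4 *_) (∑<-id d))) ⟩
    d * (2 + (ℓ + q)) + 4 * Td                       ∎
    where
    e : ∀ ℓ q i → (suc ℓ + 2 * i) + (q + suc (2 * i)) ≡ (2 + (ℓ + q)) + 4 * i
    e = solve-∀
  tail-sum : ∑[ i < ℓ ] (q + (2 * d + i)) ≡ ℓ * (q + 2 * d) + Tℓ
  tail-sum = trans (∑<-cong ℓ (λ i _ → sym (+-assoc q (2 * d) i))) (∑<-affine ℓ (q + 2 * d))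
  regroup : ∀ d ℓ q Td Tℓ → d * (2 + (ℓ + q)) + 4 * Td + (ℓ * (q + 2 * d) + Tℓ) + (ℓ + Tℓ) + 2 * d
    ≡ d * (2 + (ℓ + q)) + ℓ * (q + 2 * d) + 2 * (2 * Td + d) + (2 * Tℓ + ℓ)
  regroup = solve-∀
  expand : ∀ d ℓ q → d * (2 + (ℓ + q)) + ℓ * (q + 2 * d) + 2 * (d * d) + ℓ * ℓ ≡ (ℓ + d) * (q + (2 * d + ℓ)) + 2 * d
  expand = solve-∀

-- Vertices 0, …, q − 1 form the free arc and q + p the outer vertices.
module Construction (q ℓ d : ℕ) where

  Admissible : ℕ → Set
  Admissible p = parity p ≡ 1ℙ ⊎ 2 * d ≤ p

  Adjacent : ℕ → ℕ → Set
  Adjacent x y = q ≤ y × (q ≤ x ⊎ x ≤ ℓ ⊎ Admissible (y ∸ q))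

  adjacent? : ∀ x y → Dec (Adjacent x y)
  adjacent? x y = q ≤? y ×-dec (q ≤? x ⊎-dec x ≤? ℓ ⊎-dec (parity (y ∸ q) ℙ.≟ 1ℙ ⊎-dec 2 * d ≤? y ∸ q))

  EdgeBelow : ℕ → Chord → Set
  EdgeBelow hi (x , y) = x < y × y < hi × Adjacent x y

  FromMiddle : Chord → Set
  FromMiddle (x , _) = suc ℓ ≤ x × x < q

  fromMiddle? : Decidable FromMiddle
  fromMiddle? (x , _) = suc ℓ ≤? x ×-dec x <? q

  n₀ : ℕ
  n₀ = q + (ℓ + 2 * d)

  -- The invariant of inner-bound for a matching inside a window of s outer vertices.
  Fits : ℕ → ℕ → Set
  Fits s m = 2 * m ≤ s ⊎ m + d ≤ s

  admissible-slack : ∀ {p m} → Admissible p → Fits p m → m + d ≤ p ⊎ suc (2 * m) ≤ p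
  admissible-slack {p} {m} adm fits with 2 * d ≤? p | adm
  ... | yes 2d≤p | _ = inj₁ (slack fits)
    where
    slack : Fits p m → m + d ≤ p
    slack (inj₁ 2m≤p)   = *-cancelˡ-≤ 2 (begin
      2 * (m + d)   ≡⟨ *-distribˡ-+ 2 m d ⟩
      2 * m + 2 * d ≤⟨ +-mono-≤ 2m≤p 2d≤p ⟩
      p + p         ≡⟨ cong (p +_) (sym (+-identityʳ p)) ⟩
      2 * p         ∎)
      where open ≤-Reasoning
    slack (inj₂ m+d≤p) = m+d≤p
  ... | no 2d≰p | inj₂ 2d≤p = contradiction 2d≤p 2d≰p
  ... | no 2d≰p | inj₁ odd with parity≡1ℙ⇒odd p odd
  ...   | r , refl = inj₂ (s≤s (*-monoʳ-≤ 2 (m≤r fits)))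
    where
    r<d : r < d
    r<d = *-cancelˡ-≤ 2 (subst (_≤ 2 * d) (sym (*-suc 2 r)) (≰⇒> 2d≰p))
    m≤r : Fits (suc (2 * r)) m → m ≤ r
    m≤r (inj₁ 2m≤p)  = 2*m≤1+2*n⇒m≤n 2m≤p
    m≤r (inj₂ m+d≤p) = +-cancelʳ-≤ (suc r) m r (begin
      m + suc r     ≤⟨ +-monoʳ-≤ m r<d ⟩
      m + d         ≤⟨ m+d≤p ⟩
      suc (2 * r)   ≡⟨ 1+2r≡r+[1+r] r ⟩
      r + suc r     ∎)
      where
      open ≤-Reasoning
      1+2r≡r+[1+r] : ∀ r → suc (2 * r) ≡ r + suc r
      1+2r≡r+[1+r] = solve-∀

  -- The pivot is the edge of M from the middle of the arc with leftmost arc end.  Every other edge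
  -- lies inside the pivot or after it, or goes around it from one of 0, …, ℓ: an edge around it
  -- from the middle would have a smaller arc end.
  record PivotSplit (hi : ℕ) (M : List Chord) : Set₁ where
    field
      a p₀           : ℕ
      a-middle       : FromMiddle (a , q + p₀)
      p₀-admissible  : Admissible p₀
      q+p₀<hi        : q + p₀ < hi
      inner outer    : List Chord
      length≡        : length M ≡ suc (length inner + length outer)
      outer-⊆        : ∀ {P : Chord → Set} → All P M → All P outer
      inner-disjoint : AllPairs DisjointChords inner
      outer-disjoint : AllPairs DisjointChords outer
      inner-placed   : All (λ c → a < proj₁ c × EdgeBelow (q + p₀) c) inner
      outer-placed   : All (λ c → (proj₁ c < suc ℓ ⊎ q + p₀ < proj₁ c) × q + p₀ < proj₂ c × EdgeBelow hi c) outer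

  pivot-split : ∀ {hi} M → AllPairs DisjointChords M → All (EdgeBelow hi) M → All (∁ FromMiddle) M ⊎ PivotSplit hi M
  pivot-split {hi} M disjoint below with extract-min proj₁ fromMiddle? M
  ... | inj₁ none = inj₁ none
  ... | inj₂ ((a , y₀) , rest , M↭ , a-middle , a-min)
    with AllPairs-resp-↭ DisjointChords-sym M↭ disjoint | All-resp-↭ M↭ below
  ... | pivot-apart ∷ rest-disjoint | (_ , y₀<hi , q≤y₀ , pivot-adjacent) ∷ rest-below
    with y₀ ∸ q | m+[n∸m]≡n q≤y₀
  ... | p₀ | refl = inj₂ (record
    { a              = a
    ; p₀             = p₀
    ; a-middle       = a-middle
    ; p₀-admissible  = admissible pivot-adjacent
    ; q+p₀<hi        = y₀<hi
    ; inner          = filter inside? rest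
    ; outer          = filter (∁? inside?) rest
    ; length≡        = trans (↭-length M↭) (cong suc (length-filter+filter-∁ inside? rest))
    ; outer-⊆        = All.filter⁺ (∁? inside?) ∘ All.tail ∘ All-resp-↭ M↭
    ; inner-disjoint = AllPairs.filter⁺ inside? rest-disjoint
    ; outer-disjoint = AllPairs.filter⁺ (∁? inside?) rest-disjoint
    ; inner-placed   = All.zipWith (λ ((x<y , _ , adj) , (a<x , y<y₀)) → a<x , x<y , y<y₀ , adj)
                         (All.filter⁺ inside? rest-below , All.all-filter inside? rest)
    ; outer-placed   = All.zipWith (λ ((apart , below , minimal) , ¬inside) → place apart below minimal ¬inside)
                         (All.filter⁺ (∁? inside?) (All.zip (pivot-apart , All.zip (rest-below , a-min))) ,
                          All.all-filter (∁? inside?) rest)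
    })
    where
    Inside : Chord → Set
    Inside (x , y) = a < x × y < q + p₀

    inside? : Decidable Inside
    inside? (x , y) = a <? x ×-dec y <? q + p₀

    admissible : q ≤ a ⊎ a ≤ ℓ ⊎ Admissible p₀ → Admissible p₀
    admissible (inj₁ q≤a)        = contradiction q≤a (<⇒≱ (proj₂ a-middle))
    admissible (inj₂ (inj₁ a≤ℓ)) = contradiction (proj₁ a-middle) (<⇒≱ (s≤s a≤ℓ))
    admissible (inj₂ (inj₂ adm)) = adm

    place : ∀ {c} → DisjointChords (a , q + p₀) c → EdgeBelow hi c → (FromMiddle c → a ≤ proj₁ c) → ¬ Inside c →
      (proj₁ c < suc ℓ ⊎ q + p₀ < proj₁ c) × q + p₀ < proj₂ c × EdgeBelow hi c
    place {x , y} apart below@(x<y , _ , q≤y , _) minimal ¬inside with disjoint-position x<y apart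
    ... | inside a<x y<y₀ = contradiction (a<x , y<y₀) ¬inside
    ... | left y<a         = contradiction q≤y (<⇒≱ (<-trans y<a (proj₂ a-middle)))
    ... | right y₀<x       = inj₂ y₀<x , <-trans y₀<x x<y , below
    ... | around x<a y₀<y  = inj₁ x<1+ℓ , y₀<y , below
      where
      x<1+ℓ : x < suc ℓ
      x<1+ℓ = ≰⇒> (λ 1+ℓ≤x → <⇒≱ x<a (minimal (1+ℓ≤x , <-trans x<a (proj₂ a-middle))))

  inner-step : ∀ {I O p s} → I + d ≤ p ⊎ suc (2 * I) ≤ p → 2 * O + suc p ≤ s → Fits s (suc (I + O))
  inner-step {I} {O} {p} {s} (inj₁ I+d≤p) room = inj₂ (begin
    suc (I + O) + d   ≡⟨ e₁ I O d ⟩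
    I + d + suc O     ≤⟨ +-monoˡ-≤ (suc O) I+d≤p ⟩
    p + suc O         ≡⟨ e₂ p O ⟩
    O + suc p         ≤⟨ +-monoˡ-≤ (suc p) (m≤m+n O _) ⟩
    2 * O + suc p     ≤⟨ room ⟩
    s                 ∎)
    where
    open ≤-Reasoning
    e₁ : ∀ I O d → suc (I + O) + d ≡ I + d + suc O
    e₁ = solve-∀
    e₂ : ∀ p O → p + suc O ≡ O + suc p
    e₂ = solve-∀
  inner-step {I} {O} {p} {s} (inj₂ 1+2I≤p) room = inj₁ (begin
    2 * suc (I + O)            ≡⟨ e₁ I O ⟩
    suc (2 * I) + suc (2 * O)  ≤⟨ +-monoˡ-≤ (suc (2 * O)) 1+2I≤p ⟩
    p + suc (2 * O)            ≡⟨ e₂ p O ⟩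
    2 * O + suc p              ≤⟨ room ⟩
    s                          ∎)
    where
    open ≤-Reasoning
    e₁ : ∀ I O → 2 * suc (I + O) ≡ suc (2 * I) + suc (2 * O)
    e₁ = solve-∀
    e₂ : ∀ p O → p + suc (2 * O) ≡ 2 * O + suc p
    e₂ = solve-∀

  top-step : ∀ {I O p} → I + d ≤ p ⊎ suc (2 * I) ≤ p → O + suc p ≤ ℓ + 2 * d →
    2 * O + suc p ≤ suc ℓ + (ℓ + 2 * d) → suc (I + O) ≤ ℓ + d
  top-step {I} {O} {p} (inj₁ I+d≤p) room _ = +-cancelʳ-≤ (d + p) _ _ (begin
    suc (I + O) + (d + p)      ≡⟨ e₁ I O d p ⟩
    (I + d) + (O + suc p)      ≤⟨ +-mono-≤ I+d≤p room ⟩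
    p + (ℓ + 2 * d)            ≡⟨ e₂ p ℓ d ⟩
    ℓ + d + (d + p)            ∎)
    where
    open ≤-Reasoning
    e₁ : ∀ I O d p → suc (I + O) + (d + p) ≡ (I + d) + (O + suc p)
    e₁ = solve-∀
    e₂ : ∀ p ℓ d → p + (ℓ + 2 * d) ≡ ℓ + d + (d + p)
    e₂ = solve-∀
  top-step {I} {O} {p} (inj₂ 1+2I≤p) _ room = 2*m≤1+2*n⇒m≤n (begin
    2 * suc (I + O)            ≡⟨ e₁ I O ⟩
    suc (2 * I) + suc (2 * O)  ≤⟨ +-monoˡ-≤ (suc (2 * O)) 1+2I≤p ⟩
    p + suc (2 * O)            ≡⟨ e₂ p O ⟩
    2 * O + suc p              ≤⟨ room ⟩
    suc ℓ + (ℓ + 2 * d)        ≡⟨ e₃ ℓ d ⟩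
    suc (2 * (ℓ + d))          ∎)
    where
    open ≤-Reasoning
    e₁ : ∀ I O → 2 * suc (I + O) ≡ suc (2 * I) + suc (2 * O)
    e₁ = solve-∀
    e₂ : ∀ p O → p + suc (2 * O) ≡ 2 * O + suc p
    e₂ = solve-∀
    e₃ : ∀ ℓ d → suc ℓ + (ℓ + 2 * d) ≡ suc (2 * (ℓ + d))
    e₃ = solve-∀

  inner-bound : ∀ s → Acc _<_ s → ∀ M → AllPairs DisjointChords M →
    All (λ c → suc ℓ ≤ proj₁ c × EdgeBelow (q + s) c) M → Fits s (length M)
  inner-bound s (acc smaller) M disjoint below with pivot-split M disjoint (All.map proj₂ below)
  ... | inj₁ none = inj₁ (subst (2 * length M ≤_) (m+n∸m≡n q s)
          (endpoints-pigeonhole (unique-within-length q (q + s) _) disjoint (All.map (proj₁ ∘ proj₂) below)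
             (All.zipWith ends (below , none))))
    where
    ends : ∀ {c} → (suc ℓ ≤ proj₁ c × EdgeBelow (q + s) c) × ¬ FromMiddle c →
      Within q (q + s) (proj₁ c) × Within q (q + s) (proj₂ c)
    ends ((1+ℓ≤x , x<y , y<q+s , q≤y , _) , ¬middle) =
      (≮⇒≥ (λ x<q → ¬middle (1+ℓ≤x , x<q)) , <-trans x<y y<q+s) , (q≤y , y<q+s)
  ... | inj₂ split = subst (Fits s) (sym length≡) (inner-step (admissible-slack p₀-admissible inner-fits)
          (window-bound {q = q} (endpoints-pigeonhole (unique-within-length (suc (q + p₀)) (q + s) _) outer-disjoint
             (All.map (proj₁ ∘ proj₂ ∘ proj₂) outer-placed)
             (All.zipWith ends (outer-placed , outer-⊆ (All.map proj₁ below)))) p₀<s))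
    where
    open PivotSplit split
    p₀<s : p₀ < s
    p₀<s = +-cancelˡ-< q p₀ s q+p₀<hi
    inner-fits : Fits p₀ (length inner)
    inner-fits = inner-bound p₀ (smaller p₀<s) inner inner-disjoint
      (All.map (λ (a<x , below) → ≤-trans (proj₁ a-middle) (<⇒≤ a<x) , below) inner-placed)
    ends : ∀ {c} → ((proj₁ c < suc ℓ ⊎ q + p₀ < proj₁ c) × q + p₀ < proj₂ c × EdgeBelow (q + s) c) × suc ℓ ≤ proj₁ c →
      Within (suc (q + p₀)) (q + s) (proj₁ c) × Within (suc (q + p₀)) (q + s) (proj₂ c)
    ends ((inj₁ x<1+ℓ , _) , 1+ℓ≤x) = contradiction x<1+ℓ (≤⇒≯ 1+ℓ≤x)
    ends ((inj₂ y₀<x , y₀<y , x<y , y<q+s , _) , _) = (y₀<x , <-trans x<y y<q+s) , (y₀<y , y<q+s)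

  top-bound : ∀ M → AllPairs DisjointChords M → All (EdgeBelow n₀) M → length M ≤ ℓ + d
  top-bound M disjoint below with pivot-split M disjoint below
  ... | inj₁ none = 2*m≤1+2*n⇒m≤n (begin
    2 * length M               ≤⟨ endpoints-pigeonhole (unique-within₂-length (suc ℓ) q n₀ _) disjoint
                                    (All.map proj₁ below) (All.zipWith ends (below , none)) ⟩
    suc ℓ + (n₀ ∸ q)            ≡⟨ cong (suc ℓ +_) (m+n∸m≡n q (ℓ + 2 * d)) ⟩
    suc ℓ + (ℓ + 2 * d)        ≡⟨ e ℓ d ⟩
    suc (2 * (ℓ + d))          ∎)
    where
    open ≤-Reasoning
    e : ∀ ℓ d → suc ℓ + (ℓ + 2 * d) ≡ suc (2 * (ℓ + d))
    e = solve-∀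
    ends : ∀ {c} → EdgeBelow n₀ c × ¬ FromMiddle c →
      (proj₁ c < suc ℓ ⊎ Within q n₀ (proj₁ c)) × (proj₂ c < suc ℓ ⊎ Within q n₀ (proj₂ c))
    ends {x , y} ((x<y , y<N , q≤y , _) , ¬middle) with suc ℓ ≤? x
    ... | yes 1+ℓ≤x = inj₂ (≮⇒≥ (λ x<q → ¬middle (1+ℓ≤x , x<q)) , <-trans x<y y<N) , inj₂ (q≤y , y<N)
    ... | no  1+ℓ≰x = inj₁ (≰⇒> 1+ℓ≰x) , inj₂ (q≤y , y<N)
  ... | inj₂ split = subst (_≤ ℓ + d) (sym length≡)
    (top-step (admissible-slack p₀-admissible inner-fits) room room₂)
    where
    open PivotSplit split
    p₀<s : p₀ < ℓ + 2 * d
    p₀<s = +-cancelˡ-< q p₀ _ q+p₀<hi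
    inner-fits : Fits p₀ (length inner)
    inner-fits = inner-bound p₀ (<-wellFounded p₀) inner inner-disjoint
      (All.map (λ (a<x , below) → ≤-trans (proj₁ a-middle) (<⇒≤ a<x) , below) inner-placed)
    room : length outer + suc p₀ ≤ ℓ + 2 * d
    room = window-bound {L = 0} {q = q} (subst (_≤ n₀ ∸ suc (q + p₀)) (length-map proj₂ outer)
      (unique-within-length (suc (q + p₀)) n₀ _ (rights-unique outer-disjoint)
        (All.map⁺ (All.map (λ (_ , y₀<y , _ , y<N , _) → y₀<y , y<N) outer-placed)))) p₀<s
    ends : ∀ {c} → (proj₁ c < suc ℓ ⊎ q + p₀ < proj₁ c) × q + p₀ < proj₂ c × EdgeBelow n₀ c →
      (proj₁ c < suc ℓ ⊎ Within (suc (q + p₀)) n₀ (proj₁ c)) × (proj₂ c < suc ℓ ⊎ Within (suc (q + p₀)) n₀ (proj₂ c))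
    ends (inj₁ x<1+ℓ , y₀<y , _ , y<N , _) = inj₁ x<1+ℓ , inj₂ (y₀<y , y<N)
    ends (inj₂ y₀<x , y₀<y , x<y , y<N , _) = inj₂ (y₀<x , <-trans x<y y<N) , inj₂ (y₀<y , y<N)
    room₂ : 2 * length outer + suc p₀ ≤ suc ℓ + (ℓ + 2 * d)
    room₂ = window-bound {q = q} (endpoints-pigeonhole (unique-within₂-length (suc ℓ) (suc (q + p₀)) n₀ _) outer-disjoint
      (All.map (proj₁ ∘ proj₂ ∘ proj₂) outer-placed) (All.map ends outer-placed)) p₀<s

  graph : (n : ℕ) → CGG n
  graph = cgg adjacent?

  graph-IFree : ∀ {n} → n ≡ n₀ → IFree (ℓ + d) (graph n)
  graph-IFree refl M disjoint = subst (_≤ ℓ + d) (length-map chord M)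
    (top-bound (map chord M) (chords-disjoint disjoint) (All.map⁺ (All.universal below M)))
    where
    below : (e : Edge (graph n₀)) → EdgeBelow n₀ (chord e)
    below ((i , j) , i<j , adj) = i<j , toℕ<n j , does≡true⇒ (adjacent? _ _) adj

  graph-arc-free : ∀ {n q′} → q′ ≤ q → HasFreeArc (graph (suc n)) q′
  graph-arc-free q′≤q = cgg-arc-free adjacent? (λ y<q′ (q≤y , _) → <⇒≱ (<-≤-trans y<q′ q′≤q) q≤y)

  column : ℕ → ℕ
  column y = ∑[ x < y ] ⟦ adjacent? x y ⟧

  column-arc : ∀ {y} → y < q → column y ≡ 0
  column-arc {y} y<q = ∑<-zero y (λ x _ → ⟦⟧-no (adjacent? x y) (λ (q≤y , _) → <⇒≱ y<q q≤y))

  column-admissible : ∀ {p} → Admissible p → column (q + p) ≡ q + p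
  column-admissible {p} adm = ∑<-ones (q + p) (λ x _ →
    ⟦⟧-yes (adjacent? x (q + p)) (m≤m+n q p , inj₂ (inj₂ (subst Admissible (sym (m+n∸m≡n q p)) adm))))

  column-inadmissible : ∀ {p} → ℓ < q → ¬ Admissible p → column (q + p) ≡ suc ℓ + p
  column-inadmissible {p} ℓ<q ¬adm = begin
    ∑< (q + p) h                                               ≡⟨ cong (λ m → ∑< m h) q+p≡ ⟩
    ∑< (suc ℓ + (r + p)) h                                     ≡⟨ ∑<-+ (suc ℓ) (r + p) h ⟩
    ∑< (suc ℓ) h + ∑[ i < r + p ] h (suc ℓ + i)                ≡⟨ cong (∑< (suc ℓ) h +_) (∑<-+ r p _) ⟩
    ∑< (suc ℓ) h + (∑[ i < r ] h (suc ℓ + i) + ∑[ i < p ] h (suc ℓ + (r + i)))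
      ≡⟨ cong₂ _+_ (∑<-ones (suc ℓ) low) (cong₂ _+_ (∑<-zero r middle) (∑<-ones p high)) ⟩
    suc ℓ + (0 + p)                                            ∎
    where
    open ≡-Reasoning
    r : ℕ
    r = q ∸ suc ℓ
    q≡ : q ≡ suc ℓ + r
    q≡ = sym (m+[n∸m]≡n ℓ<q)
    q+p≡ : q + p ≡ suc ℓ + (r + p)
    q+p≡ = trans (cong (_+ p) q≡) (+-assoc (suc ℓ) r p)
    h : ℕ → ℕ
    h x = ⟦ adjacent? x (q + p) ⟧
    low : ∀ x → x < suc ℓ → h x ≡ 1
    low x x<1+ℓ = ⟦⟧-yes (adjacent? x (q + p)) (m≤m+n q p , inj₂ (inj₁ (s≤s⁻¹ x<1+ℓ)))
    middle : ∀ i → i < r → h (suc ℓ + i) ≡ 0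
    middle i i<r = ⟦⟧-no (adjacent? _ (q + p)) λ where
      (_ , inj₁ q≤x)              → <⇒≱ (subst (suc ℓ + i <_) (sym q≡) (+-monoʳ-< (suc ℓ) i<r)) q≤x
      (_ , inj₂ (inj₁ x≤ℓ))       → <⇒≱ (s≤s (m≤m+n ℓ i)) x≤ℓ
      (_ , inj₂ (inj₂ adm))       → ¬adm (subst Admissible (m+n∸m≡n q p) adm)
    high : ∀ i → i < p → h (suc ℓ + (r + i)) ≡ 1
    high i _ = ⟦⟧-yes (adjacent? _ (q + p))
      (m≤m+n q p , inj₁ (subst (_≤ suc ℓ + (r + i)) (sym q≡) (+-monoʳ-≤ (suc ℓ) (m≤m+n r i))))

  edgeCount-graph : ℓ < q → edgeCount (graph (q + (2 * d + ℓ))) + triangular (suc ℓ) ≡ (ℓ + d) * (q + (2 * d + ℓ))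
  edgeCount-graph ℓ<q = trans (cong (_+ triangular (suc ℓ)) columns) (construction-count q ℓ d)
    where
    open ≡-Reasoning
    columns : edgeCount (graph (q + (2 * d + ℓ))) ≡
      ∑[ i < d ] ((suc ℓ + 2 * i) + (q + suc (2 * i))) + ∑[ i < ℓ ] (q + (2 * d + i))
    columns = begin
      edgeCount (graph (q + (2 * d + ℓ)))                    ≡⟨ edgeCount-cgg adjacent? (q + (2 * d + ℓ)) ⟩
      ∑< (q + (2 * d + ℓ)) column                            ≡⟨ ∑<-+ q (2 * d + ℓ) column ⟩
      ∑< q column + ∑[ p < 2 * d + ℓ ] column (q + p)        ≡⟨ cong (_+ ∑[ p < 2 * d + ℓ ] column (q + p)) (∑<-zero q (λ y y<q → column-arc y<q)) ⟩
      ∑[ p < 2 * d + ℓ ] column (q + p)                      ≡⟨ ∑<-+ (2 * d) ℓ (λ p → column (q + p)) ⟩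
      ∑[ p < 2 * d ] column (q + p) + ∑[ i < ℓ ] column (q + (2 * d + i))
        ≡⟨ cong₂ _+_ (trans (∑<-pairs d (λ p → column (q + p))) (∑<-cong d (λ i i<d →
                        cong₂ _+_ (column-inadmissible ℓ<q (even-inadmissible i<d))
                                  (column-admissible (inj₁ (parity[1+2*n]≡1ℙ i))))))
                     (∑<-cong ℓ (λ i _ → column-admissible (inj₂ (m≤m+n (2 * d) i)))) ⟩
      ∑[ i < d ] ((suc ℓ + 2 * i) + (q + suc (2 * i))) + ∑[ i < ℓ ] (q + (2 * d + i)) ∎
      where
      even-inadmissible : ∀ {i} → i < d → ¬ Admissible (2 * i)
      even-inadmissible {i} _   (inj₁ odd)   = contradiction (trans (sym (parity[2*n]≡0ℙ i)) odd) λ ()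
      even-inadmissible {i} i<d (inj₂ 2d≤2i) = <⇒≱ i<d (*-cancelˡ-≤ 2 2d≤2i)

-- The construction for (3)

module Saturated (q : ℕ) where

  graph : (n : ℕ) → CGG n
  graph = cgg (λ _ y → q ≤? y)

  graph-IFree : ∀ {n k} → n ∸ k ≤ q → IFree k (graph n)
  graph-IFree {n} {k} n∸k≤q M disjoint = begin
    length M                           ≡⟨ trans (length-map proj₂ (map chord M)) (length-map chord M) ⟨
    length (map proj₂ (map chord M))   ≤⟨ unique-within-length q n _ (rights-unique (chords-disjoint disjoint))
                                            (All.map⁺ (All.map⁺ (All.universal right-end M))) ⟩
    n ∸ q                              ≤⟨ m≤n+o⇒m∸n≤o n q n≤q+k ⟩
    k                                  ∎
    where
    open ≤-Reasoning
    right-end : (e : Edge (graph n)) → Within q n (proj₂ (chord e))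
    right-end ((_ , j) , _ , q≤j) = does≡true⇒ (q ≤? toℕ j) q≤j , toℕ<n j
    n≤q+k : n ≤ q + k
    n≤q+k = ≤-trans (m≤n+m∸n n k) (≤-trans (+-monoʳ-≤ k n∸k≤q) (≤-reflexive (+-comm k q)))

  graph-arc-free : ∀ {n} → HasFreeArc (graph (suc n)) q
  graph-arc-free = cgg-arc-free (λ _ y → q ≤? y) (λ y<q q≤y → <⇒≱ y<q q≤y)

  edgeCount-graph : ∀ r → edgeCount (graph (q + r)) + triangular q ≡ triangular (q + r)
  edgeCount-graph r = begin
    edgeCount (graph (q + r)) + triangular q
      ≡⟨ cong (_+ triangular q) (edgeCount-cgg (λ _ y → q ≤? y) (q + r)) ⟩
    ∑[ y < q + r ] ∑[ x < y ] ⟦ q ≤? y ⟧ + triangular q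
      ≡⟨ cong (_+ triangular q) (∑<-+ q r _) ⟩
    ∑[ y < q ] ∑[ x < y ] ⟦ q ≤? y ⟧ + ∑[ i < r ] ∑[ x < q + i ] ⟦ q ≤? q + i ⟧ + triangular q
      ≡⟨ cong₂ (λ a b → a + b + triangular q)
           (∑<-zero q (λ y y<q → ∑<-zero y (λ _ _ → ⟦⟧-no (q ≤? y) (<⇒≱ y<q))))
           (∑<-cong r (λ i _ → ∑<-ones (q + i) (λ _ _ → ⟦⟧-yes (q ≤? q + i) (m≤m+n q i)))) ⟩
    ∑[ i < r ] (q + i) + triangular q
      ≡⟨ cong (_+ triangular q) (∑<-affine r q) ⟩
    r * q + triangular r + triangular q
      ≡⟨ +-comm _ (triangular q) ⟩
    triangular q + (r * q + triangular r)
      ≡⟨ triangular-+ q r ⟨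
    triangular (q + r) ∎
    where open ≡-Reasoning

-- Kupitz classes

Congruent : ℕ → ℕ → ℕ → Set
Congruent n a b = a ≡ b ⊎ a ≡ b + n ⊎ b ≡ a + n

Congruent-sym : ∀ {n a b} → Congruent n a b → Congruent n b a
Congruent-sym (inj₁ a≡b)        = inj₁ (sym a≡b)
Congruent-sym (inj₂ (inj₁ a≡b+n)) = inj₂ (inj₂ a≡b+n)
Congruent-sym (inj₂ (inj₂ b≡a+n)) = inj₂ (inj₁ b≡a+n)

congruent-cancelʳ : ∀ {n u v w} → Congruent n (u + w) (v + w) → u < n → v < n → u ≡ v
congruent-cancelʳ {n} {u} {v} {w} (inj₁ eq)         _   _   = +-cancelʳ-≡ w u v eq
congruent-cancelʳ {n} {u} {v} {w} (inj₂ (inj₁ eq)) u<n _   =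
  contradiction (+-cancelʳ-≡ w u (v + n) (trans eq (+-comm-middle v w n))) (<⇒≢ (<-≤-trans u<n (m≤n+m n v)))
  where
  +-comm-middle : ∀ v w n → v + w + n ≡ v + n + w
  +-comm-middle = solve-∀
congruent-cancelʳ {n} {u} {v} {w} (inj₂ (inj₂ eq)) _   v<n =
  contradiction (+-cancelʳ-≡ w v (u + n) (trans eq (+-comm-middle u w n))) (<⇒≢ (<-≤-trans v<n (m≤n+m n u)))
  where
  +-comm-middle : ∀ u w n → u + w + n ≡ u + n + w
  +-comm-middle = solve-∀

alternating-incongruent : ∀ {n x₁ x₂ x₃ x₄} → x₁ < x₂ → x₂ < x₃ → x₃ < x₄ → x₄ < n →
  ¬ Congruent n (x₁ + x₃) (x₂ + x₄)
alternating-incongruent x₁<x₂ _ x₃<x₄ _ (inj₁ eq) = <⇒≢ (+-mono-< x₁<x₂ x₃<x₄) eq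
alternating-incongruent {n} x₁<x₂ _ x₃<x₄ _ (inj₂ (inj₁ eq)) =
  <⇒≢ (<-≤-trans (+-mono-< x₁<x₂ x₃<x₄) (m≤m+n _ n)) eq
alternating-incongruent {n} {x₁} {x₂} {x₃} {x₄} _ x₂<x₃ _ x₄<n (inj₂ (inj₂ eq)) = <⇒≢ (begin-strict
  x₂ + x₄        <⟨ +-mono-< x₂<x₃ x₄<n ⟩
  x₃ + n         ≤⟨ +-monoˡ-≤ n (m≤n+m x₃ x₁) ⟩
  x₁ + x₃ + n    ∎) eq
  where open ≤-Reasoning

-- t mod n, for t < 2n.
wrap : ℕ → ℕ → ℕ
wrap n t = if does (t <? n) then t else t ∸ n

wrap-< : ∀ {n t} → t < n + n → wrap n t < n
wrap-< {n} {t} t<2n with t <? n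
... | yes t<n rewrite dec-true (t <? n) t<n = t<n
... | no  t≮n rewrite dec-false (t <? n) t≮n = +-cancelʳ-< n _ _ (subst (_< n + n) (sym (m∸n+n≡m (≮⇒≥ t≮n))) t<2n)

wrap-congruent : ∀ {n t t′} → wrap n t ≡ wrap n t′ → Congruent n t t′
wrap-congruent {n} {t} {t′} eq with t <? n | t′ <? n
... | yes t<n | yes t′<n rewrite dec-true (t <? n) t<n | dec-true (t′ <? n) t′<n = inj₁ eq
... | yes t<n | no t′≮n rewrite dec-true (t <? n) t<n | dec-false (t′ <? n) t′≮n =
  inj₂ (inj₂ (trans (sym (m∸n+n≡m (≮⇒≥ t′≮n))) (cong (_+ n) (sym eq))))
... | no t≮n | yes t′<n rewrite dec-false (t <? n) t≮n | dec-true (t′ <? n) t′<n =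
  inj₂ (inj₁ (trans (sym (m∸n+n≡m (≮⇒≥ t≮n))) (cong (_+ n) eq)))
... | no t≮n | no t′≮n rewrite dec-false (t <? n) t≮n | dec-false (t′ <? n) t′≮n =
  inj₁ (trans (sym (m∸n+n≡m (≮⇒≥ t≮n))) (trans (cong (_+ n) eq) (m∸n+n≡m (≮⇒≥ t′≮n))))

wrap-cases : ∀ {n t σ} → wrap n t ≡ σ → t ≡ σ ⊎ t ≡ σ + n
wrap-cases {n} {t} eq with t <? n
... | yes t<n rewrite dec-true (t <? n) t<n = inj₁ eq
... | no  t≮n rewrite dec-false (t <? n) t≮n = inj₂ (trans (sym (m∸n+n≡m (≮⇒≥ t≮n))) (cong (_+ n) eq))

-- offsetℕ n (toℕ s) (toℕ v) unfolds to offset s v.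
offsetℕ : ℕ → ℕ → ℕ → ℕ
offsetℕ n s x = if does (s ≤? x) then x ∸ s else x + n ∸ s

module Rotation {n s : ℕ} (s<n : s < n) where

  o : ℕ → ℕ
  o = offsetℕ n s

  o-above : ∀ {x} → s ≤ x → o x + s ≡ x
  o-above {x} s≤x rewrite dec-true (s ≤? x) s≤x = m∸n+n≡m s≤x

  o-below : ∀ {x} → x < s → o x + s ≡ x + n
  o-below {x} x<s rewrite dec-false (s ≤? x) (<⇒≱ x<s) = m∸n+n≡m (≤-trans (<⇒≤ s<n) (m≤n+m n x))

  o-< : ∀ {x} → x < n → o x < n
  o-< {x} x<n with s ≤? x
  ... | yes s≤x = +-cancelʳ-< s _ _ (subst (_< n + s) (sym (o-above s≤x)) (<-≤-trans x<n (m≤m+n n s)))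
  ... | no  s≰x = +-cancelʳ-< s _ _ (subst (_< n + s) (sym (o-below (≰⇒> s≰x)))
                    (subst (_< n + s) (+-comm n x) (+-monoʳ-< n (≰⇒> s≰x))))

  o-injective : ∀ {x y} → x < n → y < n → o x ≡ o y → x ≡ y
  o-injective {x} {y} x<n y<n eq with s ≤? x | s ≤? y
  ... | yes s≤x | yes s≤y = trans (sym (o-above s≤x)) (trans (cong (_+ s) eq) (o-above s≤y))
  ... | no  s≰x | no  s≰y =
    +-cancelʳ-≡ n x y (trans (sym (o-below (≰⇒> s≰x))) (trans (cong (_+ s) eq) (o-below (≰⇒> s≰y))))
  ... | yes s≤x | no  s≰y = contradiction (trans (sym (o-below (≰⇒> s≰y))) (trans (cong (_+ s) (sym eq)) (o-above s≤x)))
                              (<⇒≢ (<-≤-trans x<n (m≤n+m n y)) ∘ sym)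
  ... | no  s≰x | yes s≤y = contradiction (trans (sym (o-below (≰⇒> s≰x))) (trans (cong (_+ s) eq) (o-above s≤y)))
                              (<⇒≢ (<-≤-trans y<n (m≤n+m n x)) ∘ sym)

  o-mono-above : ∀ {x y} → s ≤ x → x < y → o x < o y
  o-mono-above s≤x x<y =
    +-cancelʳ-< s _ _ (subst₂ _<_ (sym (o-above s≤x)) (sym (o-above (≤-trans s≤x (<⇒≤ x<y)))) x<y)

  o-mono-below : ∀ {x y} → x < y → y < s → o x < o y
  o-mono-below x<y y<s =
    +-cancelʳ-< s _ _ (subst₂ _<_ (sym (o-below (<-trans x<y y<s))) (sym (o-below y<s)) (+-monoˡ-< n x<y))

  o-wrap : ∀ {x y} → x < s → s ≤ y → y < n → o y < o x
  o-wrap x<s s≤y y<n =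
    +-cancelʳ-< s _ _ (subst₂ _<_ (sym (o-above s≤y)) (sym (o-below x<s)) (<-≤-trans y<n (m≤n+m n _)))

  -- Wherever s falls among a < c < b < d, the offsets of the two chords still alternate.
  crossing-incongruent : ∀ {a b c d} → a < c → c < b → b < d → d < n → ¬ Congruent n (o a + o b) (o c + o d)
  crossing-incongruent {a} {b} {c} {d} a<c c<b b<d d<n ≅ with s ≤? a
  ... | yes s≤a = alternating-incongruent (o-mono-above s≤a a<c) (o-mono-above (≤-trans s≤a (<⇒≤ a<c)) c<b)
                    (o-mono-above (≤-trans s≤a (<⇒≤ (<-trans a<c c<b))) b<d) (o-< d<n) ≅
  ... | no s≰a with s ≤? c
  ...   | yes s≤c = alternating-incongruent (o-mono-above s≤c c<b) (o-mono-above (≤-trans s≤c (<⇒≤ c<b)) b<d)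
                      (o-wrap (≰⇒> s≰a) (≤-trans s≤c (<⇒≤ (<-trans c<b b<d))) d<n) (o-< a<n)
                      (subst (Congruent n _) (+-comm (o a) (o b)) (Congruent-sym ≅))
    where a<n = <-trans a<c (<-trans c<b (<-trans b<d d<n))
  ...   | no s≰c with s ≤? b
  ...     | yes s≤b = alternating-incongruent (o-mono-above s≤b b<d) (o-wrap (≰⇒> s≰a) (≤-trans s≤b (<⇒≤ b<d)) d<n)
                        (o-mono-below a<c (≰⇒> s≰c)) (o-< (<-trans c<b (<-trans b<d d<n)))
                        (subst₂ (Congruent n) (+-comm (o a) (o b)) (+-comm (o c) (o d)) ≅)
  ...     | no s≰b with s ≤? d
  ...       | yes s≤d = alternating-incongruent (o-wrap (≰⇒> s≰a) s≤d d<n) (o-mono-below a<c (≰⇒> s≰c))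
                          (o-mono-below c<b (≰⇒> s≰b)) (o-< (<-trans b<d d<n))
                          (subst (λ t → Congruent n t (o a + o b)) (+-comm (o c) (o d)) (Congruent-sym ≅))
  ...       | no s≰d = alternating-incongruent (o-mono-below a<c (≰⇒> s≰c)) (o-mono-below c<b (≰⇒> s≰b))
                         (o-mono-below b<d (≰⇒> s≰d)) (o-< d<n) ≅

  class : ℕ → ℕ → ℕ
  class x y = wrap n (o x + o y)

  class-< : ∀ {x y} → x < n → y < n → class x y < n
  class-< x<n y<n = wrap-< (+-mono-< (o-< x<n) (o-< y<n))

  same-class⇒disjoint : ∀ {a b c d} → a < b → b < n → c < d → d < n → class a b ≡ class c d →
    (a , b) ≢ (c , d) → DisjointChords (a , b) (c , d)
  same-class⇒disjoint {a} {b} {c} {d} a<b b<n c<d d<n same distinct = (a≢c , a≢d , b≢c , b≢d) , ¬cross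
    where
    ≅ : Congruent n (o a + o b) (o c + o d)
    ≅ = wrap-congruent same
    a<n : a < n
    a<n = <-trans a<b b<n
    c<n : c < n
    c<n = <-trans c<d d<n
    partners-equal : ∀ {x y z w} → x ≡ w → y < n → z < n → Congruent n (o y + o x) (o z + o w) → y ≡ z
    partners-equal refl y<n z<n ≅ = o-injective y<n z<n (congruent-cancelʳ ≅ (o-< y<n) (o-< z<n))
    a≢c : a ≢ c
    a≢c a≡c = distinct (cong₂ _,_ a≡c
      (partners-equal a≡c b<n d<n (subst₂ (Congruent n) (+-comm (o a) (o b)) (+-comm (o c) (o d)) ≅)))
    a≢d : a ≢ d
    a≢d a≡d = <⇒≢ (<-trans a<b (subst (_< d) (sym b≡c) c<d)) a≡d
      where
      b≡c : b ≡ c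
      b≡c = partners-equal a≡d b<n c<n (subst (λ t → Congruent n t (o c + o d)) (+-comm (o a) (o b)) ≅)
    b≢c : b ≢ c
    b≢c b≡c = <⇒≢ (<-trans a<b (subst (_< d) (sym b≡c) c<d)) a≡d
      where
      a≡d : a ≡ d
      a≡d = partners-equal b≡c a<n d<n (subst (Congruent n (o a + o b)) (+-comm (o c) (o d)) ≅)
    b≢d : b ≢ d
    b≢d b≡d = distinct (cong₂ _,_ (partners-equal b≡d a<n c<n ≅) b≡d)
    ¬cross : ¬ Crosses (a , b) (c , d)
    ¬cross (inj₁ (a<c , c<b , b<d)) = crossing-incongruent a<c c<b b<d d<n ≅
    ¬cross (inj₂ (c<a , a<d , d<b)) = crossing-incongruent c<a a<d d<b b<n (Congruent-sym ≅)

module Classes {n : ℕ} (G : CGG n) (s : Fin n) where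

  open Rotation (toℕ<n s) public

  class-of : Edge G → ℕ
  class-of ((i , j) , _) = class (toℕ i) (toℕ j)

  members : ℕ → List (Edge G)
  members σ = filter (λ e → class-of e ≟ σ) (edges G)

  members-disjoint : ∀ σ → AllPairs Disjoint (members σ)
  members-disjoint σ = AllPairs-restrict (λ {e} {f} → same-class-disjoint {e} {f})
    (All.all-filter (λ e → class-of e ≟ σ) (edges G)) (AllPairs.filter⁺ (λ e → class-of e ≟ σ) (edges-distinct G))
    where
    same-class-disjoint : ∀ {e f} → class-of e ≡ σ → class-of f ≡ σ → proj₁ e ≢ proj₁ f → Disjoint e f
    same-class-disjoint {e@((i , j) , i<j , _)} {f@((k , l) , k<l , _)} e∈σ f∈σ e≢f = chord-disjoint⁻ {e = e} {f = f}
      (same-class⇒disjoint i<j (toℕ<n j) k<l (toℕ<n l) (trans e∈σ (sym f∈σ))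
        (λ eq → e≢f (cong₂ _,_ (toℕ-injective (cong proj₁ eq)) (toℕ-injective (cong proj₂ eq)))))

  edgeCount≡∑members : edgeCount G ≡ ∑[ σ < n ] length (members σ)
  edgeCount≡∑members = trans (sym (length-edges G))
    (length≡∑-classes n class-of (edges G) (All.universal (λ ((i , j) , _) → class-< (toℕ<n i) (toℕ<n j)) _))

  kupitz-bound : ∀ {k} → IFree k G → edgeCount G ≤ k * n
  kupitz-bound {k} free = begin
    edgeCount G                        ≡⟨ edgeCount≡∑members ⟩
    ∑[ σ < n ] length (members σ)      ≤⟨ ∑<-mono-≤ n (λ σ _ → free (members σ) (members-disjoint σ)) ⟩
    ∑[ σ < n ] k                       ≡⟨ ∑<-const n k ⟩
    n * k                              ≡⟨ *-comm n k ⟩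
    k * n                              ∎
    where open ≤-Reasoning

-- Edges next to the free arc

-- Every edge of a class leaving the arc contributes its outer end twice, once to outer-ends and
-- once to leaving-end; the former are distinct outer vertices, the latter distinct vertices of
-- the zone of the class.
module Zones (n q : ℕ) where

  outer-ends : Chord → List ℕ
  outer-ends (a , b) = filter (q ≤?_) (a ∷ b ∷ [])

  leaving-end : Chord → List ℕ
  leaving-end c = if does (q ≤? proj₁ c ×-dec q ≤? proj₂ c) then [] else outer-ends c

  outer-ends⊆ : ∀ {P : ℕ → Set} c → P (proj₁ c) → P (proj₂ c) → All P (outer-ends c)
  outer-ends⊆ c pa pb = All.filter⁺ (q ≤?_) (pa ∷ pb ∷ [])

  leaving-end⊆ : ∀ {P : ℕ → Set} c → P (proj₁ c) → P (proj₂ c) → All P (leaving-end c)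
  leaving-end⊆ c pa pb with does (q ≤? proj₁ c ×-dec q ≤? proj₂ c)
  ... | true  = []
  ... | false = outer-ends⊆ c pa pb

  outer-ends-unique : ∀ c → proj₁ c ≢ proj₂ c → Unique (outer-ends c)
  outer-ends-unique c a≢b = Unique.filter⁺ (q ≤?_) ((a≢b ∷ []) ∷ [] ∷ [])

  leaving-end-unique : ∀ c → proj₁ c ≢ proj₂ c → Unique (leaving-end c)
  leaving-end-unique c a≢b with does (q ≤? proj₁ c ×-dec q ≤? proj₂ c)
  ... | true  = []
  ... | false = outer-ends-unique c a≢b

  LeavesArc : Chord → Set
  LeavesArc (a , b) = ¬ (a < q × b < q)

  two-picks : ∀ c → LeavesArc c → length (outer-ends c) + length (leaving-end c) ≡ 2
  two-picks (a , b) leaves with q ≤? a | q ≤? b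
  ... | yes q≤a | yes q≤b rewrite dec-true (q ≤? a) q≤a | dec-true (q ≤? b) q≤b = refl
  ... | yes q≤a | no  q≰b rewrite dec-true (q ≤? a) q≤a | dec-false (q ≤? b) q≰b = refl
  ... | no  q≰a | yes q≤b rewrite dec-false (q ≤? a) q≰a | dec-true (q ≤? b) q≤b = refl
  ... | no  q≰a | no  q≰b = contradiction (≰⇒> q≰a , ≰⇒> q≰b) leaves

  ZoneChord : ℕ → ℕ → Chord → Set
  ZoneChord lo t (u , v) = u ≢ v × u < n × v < n × LeavesArc (u , v) ×
    (u < q → Within lo (lo + t) v) × (v < q → Within lo (lo + t) u)

  leaving-end-in-zone : ∀ {lo t} c → ZoneChord lo t c → All (Within lo (lo + t)) (leaving-end c)
  leaving-end-in-zone (a , b) (_ , _ , _ , leaves , zoneᵇ , zoneᵃ) with q ≤? a | q ≤? b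
  ... | yes q≤a | yes q≤b rewrite dec-true (q ≤? a) q≤a | dec-true (q ≤? b) q≤b = []
  ... | yes q≤a | no  q≰b rewrite dec-true (q ≤? a) q≤a | dec-false (q ≤? b) q≰b = zoneᵃ (≰⇒> q≰b) ∷ []
  ... | no  q≰a | yes q≤b rewrite dec-false (q ≤? a) q≰a | dec-true (q ≤? b) q≤b = zoneᵇ (≰⇒> q≰a) ∷ []
  ... | no  q≰a | no  q≰b = contradiction (≰⇒> q≰a , ≰⇒> q≰b) leaves

  zone-bound : ∀ {lo t P} → AllPairs NoCommonEndpoint P → All (ZoneChord lo t) P → 2 * length P ≤ (n ∸ q) + t
  zone-bound {lo} {t} {P} apart zone = begin
    2 * length P
      ≡⟨ length-concatMap-pair outer-ends leaving-end P (All.map (λ {c} z → two-picks c (proj₁ (proj₂ (proj₂ (proj₂ z))))) zone) ⟨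
    length (concatMap outer-ends P) + length (concatMap leaving-end P)
      ≤⟨ +-mono-≤ (unique-within-length q n _ (picked-unique outer-ends outer-ends⊆ outer-ends-unique apart loopless)
                     (All.concat⁺ (All.map⁺ (All.map (λ {c} (_ , a<n , b<n , _) → outer-within c a<n b<n) zone))))
                  (unique-within-length lo (lo + t) _ (picked-unique leaving-end leaving-end⊆ leaving-end-unique apart loopless)
                     (All.concat⁺ (All.map⁺ (All.map (λ {c} z → leaving-end-in-zone c z) zone)))) ⟩
    (n ∸ q) + ((lo + t) ∸ lo)
      ≡⟨ cong ((n ∸ q) +_) (m+n∸m≡n lo t) ⟩
    (n ∸ q) + t ∎
    where
    open ≤-Reasoning
    loopless : All (λ c → proj₁ c ≢ proj₂ c) P
    loopless = All.map proj₁ zone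
    outer-within : ∀ c → proj₁ c < n → proj₂ c < n → All (Within q n) (outer-ends c)
    outer-within c a<n b<n = All.zipWith (λ (x<n , q≤x) → q≤x , x<n)
      (outer-ends⊆ c a<n b<n , All.all-filter (q ≤?_) (proj₁ c ∷ proj₂ c ∷ []))

zone-above : ∀ {n q′ t u w} → u < suc q′ → w < n → wrap n (u + w) ≡ q′ + t → w < suc q′ + t
zone-above {n} {q′} {t} {u} {w} u<q w<n eq with wrap-cases eq
... | inj₁ u+w≡ = s≤s (≤-trans (m≤n+m w u) (≤-reflexive u+w≡))
... | inj₂ u+w≡ = contradiction (≤-trans (m≤n+m n t) (+-cancelˡ-≤ q′ _ _ (begin
  q′ + (t + n)   ≡⟨ sym (+-assoc q′ t n) ⟩
  q′ + t + n     ≡⟨ sym u+w≡ ⟩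
  u + w          ≤⟨ +-monoˡ-≤ w (s≤s⁻¹ u<q) ⟩
  q′ + w         ∎))) (<⇒≱ w<n)
  where open ≤-Reasoning

zone-below : ∀ {n σ t u w} → u < suc (σ + t) → suc (σ + t) ≤ w → wrap n (u + w) ≡ σ → n ≤ w + t
zone-below {n} {σ} {t} {u} {w} u<q q≤w eq with wrap-cases eq
... | inj₁ u+w≡σ = contradiction (≤-trans (≤-trans (s≤s (m≤m+n σ t)) q≤w) (m≤n+m w u))
                                  (<⇒≱ (subst (_< suc σ) (sym u+w≡σ) (n<1+n σ)))
... | inj₂ u+w≡σ+n = +-cancelˡ-≤ σ n (w + t) (begin
  σ + n          ≡⟨ sym u+w≡σ+n ⟩
  u + w          ≤⟨ +-monoˡ-≤ w (s≤s⁻¹ u<q) ⟩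
  σ + t + w      ≡⟨ +-assoc σ t w ⟩
  σ + (t + w)    ≡⟨ cong (σ +_) (+-comm t w) ⟩
  σ + (w + t)    ∎)
  where open ≤-Reasoning

pair-code : ℕ → ℕ → ℕ
pair-code u v = triangular (u ⊔ v) + u ⊓ v

data Sorted (u v : ℕ) : ℕ → ℕ → Set where
  as-is   : u < v → Sorted u v u v
  swapped : v < u → Sorted u v v u

sort : ∀ {u v} → u ≢ v → ∃₂ (Sorted u v)
sort {u} {v} u≢v with <-cmp u v
... | tri< u<v _ _ = u , v , as-is u<v
... | tri≈ _ u≡v _ = contradiction u≡v u≢v
... | tri> _ _ v<u = v , u , swapped v<u

Sorted⇒< : ∀ {u v x y} → Sorted u v x y → x < y
Sorted⇒< (as-is u<v)   = u<v
Sorted⇒< (swapped v<u) = v<u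

pair-code-sorted : ∀ {u v x y} → Sorted u v x y → pair-code u v ≡ triangular y + x
pair-code-sorted (as-is u<v)   = cong₂ (λ a b → triangular a + b) (m≤n⇒m⊔n≡n (<⇒≤ u<v)) (m≤n⇒m⊓n≡m (<⇒≤ u<v))
pair-code-sorted (swapped v<u) = cong₂ (λ a b → triangular a + b) (m≥n⇒m⊔n≡m (<⇒≤ v<u)) (m≥n⇒m⊓n≡n (<⇒≤ v<u))

triangular+<triangular : ∀ {x y z} → x < y → y < z → triangular y + x < triangular z
triangular+<triangular {x} {y} {z} x<y y<z =
  <-≤-trans (+-monoʳ-< (triangular y) x<y) (subst (_≤ triangular z) (+-comm y (triangular y)) (triangular-mono-≤ y<z))

triangular+-injective : ∀ {x y x′ y′} → x < y → x′ < y′ → triangular y + x ≡ triangular y′ + x′ → x ≡ x′ × y ≡ y′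
triangular+-injective {x} {y} {x′} {y′} x<y x′<y′ eq with <-cmp y y′
... | tri< y<y′ _ _ =
  ⊥-elim (<⇒≱ (triangular+<triangular x<y y<y′) (subst (triangular y′ ≤_) (sym eq) (m≤m+n (triangular y′) x′)))
... | tri> _ _ y′<y =
  ⊥-elim (<⇒≱ (triangular+<triangular x′<y′ y′<y) (subst (triangular y ≤_) eq (m≤m+n (triangular y) x)))
... | tri≈ _ refl _ = +-cancelˡ-≡ (triangular y) x x′ eq , refl

pair-code-injective : ∀ {u v u′ v′} → u ≢ v → u′ ≢ v′ → pair-code u v ≡ pair-code u′ v′ →
  (u ≡ u′ × v ≡ v′) ⊎ (u ≡ v′ × v ≡ u′)
pair-code-injective u≢v u′≢v′ eq with sort u≢v | sort u′≢v′
... | x , y , s | x′ , y′ , s′ with triangular+-injective (Sorted⇒< s) (Sorted⇒< s′)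
                                      (trans (sym (pair-code-sorted s)) (trans eq (pair-code-sorted s′)))
...   | refl , refl = same s s′
  where
  same : ∀ {u v u′ v′ x y} → Sorted u v x y → Sorted u′ v′ x y → (u ≡ u′ × v ≡ v′) ⊎ (u ≡ v′ × v ≡ u′)
  same (as-is _)   (as-is _)   = inj₁ (refl , refl)
  same (as-is _)   (swapped _) = inj₂ (refl , refl)
  same (swapped _) (as-is _)   = inj₂ (refl , refl)
  same (swapped _) (swapped _) = inj₁ (refl , refl)

pair-code-within : ∀ {q n u v} → u ≢ v → u < n → v < n → ¬ (u < q × v < q) →
  Within (triangular q) (triangular n) (pair-code u v)
pair-code-within {q} {n} u≢v u<n v<n leaves with sort u≢v
... | x , y , s = subst (Within (triangular q) (triangular n)) (sym (pair-code-sorted s)) (within s)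
  where
  within : ∀ {x y} → Sorted _ _ x y → Within (triangular q) (triangular n) (triangular y + x)
  within {x} {y} (as-is u<v) =
    ≤-trans (triangular-mono-≤ (≮⇒≥ (λ v<q → leaves (<-trans u<v v<q , v<q)))) (m≤m+n _ x) ,
    triangular+<triangular u<v v<n
  within {x} {y} (swapped v<u) =
    ≤-trans (triangular-mono-≤ (≮⇒≥ (λ u<q → leaves (u<q , <-trans v<u u<q)))) (m≤m+n _ x) ,
    triangular+<triangular v<u u<n

module FreeArc {n : ℕ} (G : CGG n) (s : Fin n) (q : ℕ)
               (arc-free : ∀ i j → InArc s q i → InArc s q j → ¬ IsEdge G i j) where

  open Classes G s public
  open Zones n q

  offsetChord : Edge G → Chord
  offsetChord ((i , j) , _) = o (toℕ i) , o (toℕ j)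

  offsets-apart : ∀ {e f} → Disjoint e f → NoCommonEndpoint (offsetChord e) (offsetChord f)
  offsets-apart {(i , j) , _} {(k , l) , _} (i≢k , i≢l , j≢k , j≢l , _) =
    separate i≢k , separate i≢l , separate j≢k , separate j≢l
    where
    separate : ∀ {x y : Fin n} → x ≢ y → o (toℕ x) ≢ o (toℕ y)
    separate {x} {y} x≢y = x≢y ∘ toℕ-injective ∘ o-injective (toℕ<n x) (toℕ<n y)

  offsets-differ : ∀ {i j : Fin n} → toℕ i < toℕ j → o (toℕ i) ≢ o (toℕ j)
  offsets-differ {i} {j} i<j = <⇒≢ i<j ∘ o-injective (toℕ<n i) (toℕ<n j)

  edge-leaves-arc : ∀ {i j} → IsEdge G i j → ¬ (o (toℕ i) < q × o (toℕ j) < q)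
  edge-leaves-arc {i} {j} ij (i∈arc , j∈arc) = arc-free i j i∈arc j∈arc ij

  ZoneOf : ℕ → ℕ → ℕ → Set
  ZoneOf lo t σ = ∀ {u w} → u < q → q ≤ w → w < n → wrap n (u + w) ≡ σ → Within lo (lo + t) w

  member-in-zone : ∀ {lo t σ} → ZoneOf lo t σ → ∀ e → class-of e ≡ σ → ZoneChord lo t (offsetChord e)
  member-in-zone zone ((i , j) , i<j , ij) e∈σ =
    offsets-differ i<j , o-< (toℕ<n i) , o-< (toℕ<n j) , leaves ,
    (λ i∈arc → zone i∈arc (outside i∈arc) (o-< (toℕ<n j)) e∈σ) ,
    (λ j∈arc → zone j∈arc (≮⇒≥ (λ i∈arc → leaves (i∈arc , j∈arc))) (o-< (toℕ<n i))
                 (trans (cong (wrap n) (+-comm (o (toℕ j)) (o (toℕ i)))) e∈σ))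
    where
    leaves : ¬ (o (toℕ i) < q × o (toℕ j) < q)
    leaves = edge-leaves-arc (i<j , ij)
    outside : o (toℕ i) < q → q ≤ o (toℕ j)
    outside i∈arc = ≮⇒≥ (λ j∈arc → leaves (i∈arc , j∈arc))

  members-bound : ∀ {lo t σ} → ZoneOf lo t σ → 2 * length (members σ) ≤ (n ∸ q) + t
  members-bound {lo} {t} {σ} zone = subst (λ m → 2 * m ≤ (n ∸ q) + t) (length-map offsetChord (members σ))
    (zone-bound (AllPairs.map⁺ (AllPairs.map (λ {e} {f} → offsets-apart {e} {f}) (members-disjoint σ)))
      (All.map⁺ (All.map (λ {e} e∈σ → member-in-zone zone e e∈σ) (All.all-filter (λ e → class-of e ≟ σ) (edges G)))))

  members-bound-above : ∀ {q′} t → q ≡ suc q′ → 2 * length (members (q′ + t)) ≤ (n ∸ q) + t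
  members-bound-above t refl = members-bound (λ u<q q≤w w<n eq → q≤w , zone-above u<q w<n eq)

  members-bound-below : ∀ σ t → q ≡ suc (σ + t) → 2 * length (members σ) ≤ (n ∸ q) + t
  members-bound-below σ t refl = members-bound {lo = n ∸ t} (λ {u} {w} u<q q≤w w<n eq →
    m≤n+o⇒m∸n≤o n t (subst (n ≤_) (+-comm w t) (zone-below u<q q≤w eq)) ,
    <-≤-trans w<n (subst (n ≤_) (+-comm t (n ∸ t)) (m≤n+m∸n n t)))

  code-of : Edge G → ℕ
  code-of ((i , j) , _) = pair-code (o (toℕ i)) (o (toℕ j))

  complement-bound : edgeCount G ≤ triangular n ∸ triangular q
  complement-bound = subst (_≤ triangular n ∸ triangular q) (trans (length-map code-of (edges G)) (length-edges G))
    (unique-within-length (triangular q) (triangular n) (map code-of (edges G))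
      (AllPairs.map⁺ (AllPairs.map (λ {e} {f} → codes-differ {e} {f}) (edges-distinct G)))
      (All.map⁺ (All.universal code-within (edges G))))
    where
    same-vertex : ∀ {x y : Fin n} → o (toℕ x) ≡ o (toℕ y) → x ≡ y
    same-vertex {x} {y} = toℕ-injective ∘ o-injective (toℕ<n x) (toℕ<n y)
    codes-differ : ∀ {e f : Edge G} → proj₁ e ≢ proj₁ f → code-of e ≢ code-of f
    codes-differ {(i , j) , i<j , _} {(k , l) , k<l , _} e≢f eq
      with pair-code-injective (offsets-differ i<j) (offsets-differ k<l) eq
    ... | inj₁ (i≡k , j≡l) = e≢f (cong₂ _,_ (same-vertex i≡k) (same-vertex j≡l))
    ... | inj₂ (i≡l , j≡k) = <-asym i<j
      (subst₂ _<_ (cong toℕ (sym (same-vertex j≡k))) (cong toℕ (sym (same-vertex i≡l))) k<l)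
    code-within : ∀ e → Within (triangular q) (triangular n) (code-of e)
    code-within ((i , j) , i<j , ij) =
      pair-code-within (offsets-differ i<j) (o-< (toℕ<n i)) (o-< (toℕ<n j)) (edge-leaves-arc (i<j , ij))

-- The classes A + l − i and A + l + 1 + i are paired: their zone bounds (m + i)/2 and
-- (m + i + 1)/2 add up to m + i.
module _ (c : ℕ → ℕ) {A l m k : ℕ} (l≤m : l ≤ m) (m+1+l≡2k : m + suc l ≡ 2 * k)
         (c≤k : ∀ σ → c σ ≤ k)
         (above : ∀ t → 2 * c (A + l + t) ≤ m + t)
         (below : ∀ σ t → σ + t ≡ A + l → 2 * c σ ≤ m + t) where

  private
    R : ℕ
    R = m ∸ l
    m≡l+R : m ≡ l + R
    m≡l+R = sym (m+[n∸m]≡n l≤m)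

    middle upper tail : ℕ
    middle = ∑[ i < l ] c (A + suc i)
    upper  = ∑[ i < l ] c (A + suc (l + i))
    tail   = ∑[ i < R ] c (A + suc (l + (l + i)))

    split : ∑< (suc (A + l) + m) c ≡ ∑< A c + (c (A + 0) + (middle + (upper + tail)))
    split = begin
      ∑< (suc (A + l) + m) c                             ≡⟨ cong (λ x → ∑< x c) (reorder A l m R m≡l+R) ⟩
      ∑< (A + suc (l + (l + R))) c                       ≡⟨ ∑<-+ A _ c ⟩
      ∑< A c + (c (A + 0) + ∑[ i < l + (l + R) ] c (A + suc i))
        ≡⟨ cong (λ x → ∑< A c + (c (A + 0) + x)) (trans (∑<-+ l (l + R) (λ i → c (A + suc i)))
             (cong (middle +_) (∑<-+ l R (λ i → c (A + suc (l + i)))))) ⟩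
      ∑< A c + (c (A + 0) + (middle + (upper + tail))) ∎
      where
      open ≡-Reasoning
      reorder : ∀ A l m R → m ≡ l + R → suc (A + l) + m ≡ A + suc (l + (l + R))
      reorder A l m R refl = solve-∀′ A l R
        where
        solve-∀′ : ∀ A l R → suc (A + l) + (l + R) ≡ A + suc (l + (l + R))
        solve-∀′ = solve-∀

    centre<k : c (A + 0) < k
    centre<k = *-cancelˡ-< 2 (c (A + 0)) k (begin-strict
      2 * c (A + 0)   ≤⟨ below (A + 0) l (cong (_+ l) (+-identityʳ A)) ⟩
      m + l           <⟨ +-monoʳ-< m (n<1+n l) ⟩
      m + suc l       ≡⟨ m+1+l≡2k ⟩
      2 * k           ∎)
      where open ≤-Reasoning

    paired : middle + upper ≤ l * m + triangular l
    paired = begin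
      middle + upper
        ≡⟨ cong (_+ upper) (∑<-reverse l (λ i → c (A + suc i))) ⟩
      ∑[ i < l ] c (A + suc (l ∸ suc i)) + upper
        ≡⟨ ∑<-distrib-+ l (λ i → c (A + suc (l ∸ suc i))) (λ i → c (A + suc (l + i))) ⟨
      ∑[ i < l ] (c (A + suc (l ∸ suc i)) + c (A + suc (l + i)))
        ≤⟨ ∑<-mono-≤ l (λ i i<l → pair-half {c (A + suc (l ∸ suc i))} {c (A + suc (l + i))} (below _ i (mirror i<l))
                                             (subst (λ σ → 2 * c σ ≤ suc (m + i)) (shift A l i)
                                               (subst (2 * c (A + l + suc i) ≤_) (+-suc m i) (above (suc i))))) ⟩
      ∑[ i < l ] (m + i)
        ≡⟨ ∑<-affine l m ⟩
      l * m + triangular l ∎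
      where
      open ≤-Reasoning
      mirror : ∀ {i} → i < l → A + suc (l ∸ suc i) + i ≡ A + l
      mirror {i} i<l = trans (+-assoc A _ i) (cong (A +_) (trans (sym (+-suc (l ∸ suc i) i)) (m∸n+n≡m i<l)))
      shift : ∀ A l i → A + l + suc i ≡ A + suc (l + i)
      shift = solve-∀

    tail≤ : tail ≤ R * k
    tail≤ = ≤-trans (∑<-mono-≤ R (λ i _ → c≤k _)) (≤-reflexive (∑<-const R k))

    prefix≤ : ∑< A c ≤ A * k
    prefix≤ = ≤-trans (∑<-mono-≤ A (λ σ _ → c≤k σ)) (≤-reflexive (∑<-const A k))

    bound≡ : A * k + (k + (l * m + triangular l + R * k)) + triangular (suc (suc l)) ≡ k * (suc (A + l) + m) + 1
    bound≡ = begin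
      A * k + (k + (l * m + Tl + R * k)) + (suc l + (l + Tl))
        ≡⟨ e₁ A k l m R Tl ⟩
      A * k + k + R * k + l * m + suc l + (2 * Tl + l)
        ≡⟨ cong (A * k + k + R * k + l * m + suc l +_) (triangular-double l) ⟩
      A * k + k + R * k + l * m + suc l + l * l
        ≡⟨ e₂ A k l m R ⟩
      A * k + k + R * k + l * (m + suc l) + 1
        ≡⟨ cong (λ x → A * k + k + R * k + l * x + 1) m+1+l≡2k ⟩
      A * k + k + R * k + l * (2 * k) + 1
        ≡⟨ e₃ A k l R ⟩
      k * (suc (A + l) + (l + R)) + 1
        ≡⟨ cong (λ x → k * (suc (A + l) + x) + 1) m≡l+R ⟨
      k * (suc (A + l) + m) + 1 ∎
      where
      open ≡-Reasoning
      Tl : ℕ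
      Tl = triangular l
      e₁ : ∀ A k l m R T → A * k + (k + (l * m + T + R * k)) + (suc l + (l + T)) ≡
                           A * k + k + R * k + l * m + suc l + (2 * T + l)
      e₁ = solve-∀
      e₂ : ∀ A k l m R → A * k + k + R * k + l * m + suc l + l * l ≡ A * k + k + R * k + l * (m + suc l) + 1
      e₂ = solve-∀
      e₃ : ∀ A k l R → A * k + k + R * k + l * (2 * k) + 1 ≡ k * (suc (A + l) + (l + R)) + 1
      e₃ = solve-∀

  case2-sum : ∑< (suc (A + l) + m) c + triangular (suc (suc l)) ≤ k * (suc (A + l) + m)
  case2-sum = +-cancelʳ-≤ 1 _ _ (begin
    ∑< (suc (A + l) + m) c + T₂ + 1
      ≡⟨ cong (λ x → x + T₂ + 1) split ⟩
    ∑< A c + (c (A + 0) + (middle + (upper + tail))) + T₂ + 1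
      ≡⟨ regroup (∑< A c) (c (A + 0)) middle upper tail T₂ ⟩
    ∑< A c + (suc (c (A + 0)) + (middle + upper + tail)) + T₂
      ≤⟨ +-monoˡ-≤ T₂ (+-mono-≤ prefix≤ (+-mono-≤ centre<k (+-mono-≤ paired tail≤))) ⟩
    A * k + (k + (l * m + triangular l + R * k)) + T₂
      ≡⟨ bound≡ ⟩
    k * (suc (A + l) + m) + 1 ∎)
    where
    open ≤-Reasoning
    T₂ : ℕ
    T₂ = triangular (suc (suc l))
    regroup : ∀ S c₀ x y z T → S + (c₀ + (x + (y + z))) + T + 1 ≡ S + (suc c₀ + (x + y + z)) + T
    regroup = solve-∀

half-bound : ∀ {n k} → 1 ≤ k → k ≤ ⌊ n /2⌋ ∸ 1 → 2 * k < n
half-bound {n} {k} 1≤k k≤ = begin-strict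
  2 * k                      <⟨ *-monoʳ-< 2 (n<1+n k) ⟩
  2 * suc k                  ≤⟨ *-monoʳ-≤ 2 (subst (_≤ ⌊ n /2⌋) (+-comm k 1) (m≤o∸n⇒m+n≤o k 1≤⌊n/2⌋ k≤)) ⟩
  2 * ⌊ n /2⌋                ≤⟨ +-monoʳ-≤ ⌊ n /2⌋ (≤-trans (≤-reflexive (+-identityʳ _)) (⌊n/2⌋≤⌈n/2⌉ n)) ⟩
  ⌊ n /2⌋ + ⌈ n /2⌉          ≡⟨ ⌊n/2⌋+⌈n/2⌉≡n n ⟩
  n                          ∎
  where
  open ≤-Reasoning
  1≤⌊n/2⌋ : 1 ≤ ⌊ n /2⌋
  1≤⌊n/2⌋ = ≤-trans 1≤k (≤-trans k≤ (m∸n≤m ⌊ n /2⌋ 1))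

construction-attains : ∀ {n k ℓ q} → 2 * k < suc n → ℓ < k → q ≤ suc n ∸ 2 * k + ℓ →
  ∃ λ (G : CGG (suc n)) → IFree k G × HasFreeArc G q × edgeCount G + triangular (suc ℓ) ≡ k * suc n
construction-attains {n} {k} {ℓ} 2k<N ℓ<k q≤ =
  graph N , subst (λ k → IFree k (graph N)) ℓ+d≡k (graph-IFree N≡) , graph-arc-free q≤ , count
  where
  N A d : ℕ
  N = suc n
  A = N ∸ 2 * k
  d = k ∸ ℓ
  open Construction (A + ℓ) ℓ d
  ℓ+d≡k : ℓ + d ≡ k
  ℓ+d≡k = m+[n∸m]≡n (<⇒≤ ℓ<k)
  N≡ : N ≡ A + ℓ + (ℓ + 2 * d)
  N≡ = begin
    N                   ≡⟨ m∸n+n≡m (<⇒≤ 2k<N) ⟨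
    A + 2 * k           ≡⟨ cong (λ k → A + 2 * k) ℓ+d≡k ⟨
    A + 2 * (ℓ + d)     ≡⟨ regroup A ℓ d ⟩
    A + ℓ + (ℓ + 2 * d) ∎
    where
    open ≡-Reasoning
    regroup : ∀ A ℓ d → A + 2 * (ℓ + d) ≡ A + ℓ + (ℓ + 2 * d)
    regroup = solve-∀
  count : edgeCount (graph N) + triangular (suc ℓ) ≡ k * N
  count = subst₂ (λ N K → edgeCount (graph N) + triangular (suc ℓ) ≡ K * N)
    (sym (trans N≡ (cong (A + ℓ +_) (+-comm ℓ (2 * d))))) ℓ+d≡k
    (edgeCount-graph (+-monoˡ-< ℓ (m+n≤o⇒m≤o∸n 1 2k<N)))

case2-upper : ∀ {n k l q} → 2 * k < suc n → suc l < k → q ≡ suc n ∸ 2 * k + suc l →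
  (H : CGG (suc n)) → IFree k H → HasFreeArc H q → edgeCount H + triangular (suc (suc l)) ≤ k * suc n
case2-upper {n} {k} {l} {q} 2k<N ℓ<k q≡ H free (s , arc-free) = begin
  edgeCount H + triangular (suc ℓ)             ≡⟨ cong (_+ triangular (suc ℓ)) edgeCount≡∑members ⟩
  ∑< N c + triangular (suc ℓ)                  ≡⟨ cong (λ x → ∑< x c + triangular (suc ℓ)) size ⟨
  ∑< (suc (A + l) + m) c + triangular (suc ℓ)  ≤⟨ case2-sum c l≤m m+1+l≡2k (λ σ → free (members σ) (members-disjoint σ))
                                                    (λ t → members-bound-above t q≡1+A+l)
                                                    (λ σ t eq → members-bound-below σ t (trans q≡1+A+l (cong suc (sym eq)))) ⟩
  k * (suc (A + l) + m)                        ≡⟨ cong (k *_) size ⟩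
  k * N                                        ∎
  where
  open FreeArc H s q arc-free
  open ≤-Reasoning
  N ℓ A m : ℕ
  N = suc n
  ℓ = suc l
  A = N ∸ 2 * k
  c : ℕ → ℕ
  c σ = length (members σ)
  m = N ∸ q
  q≡1+A+l : q ≡ suc (A + l)
  q≡1+A+l = trans q≡ (+-suc A l)
  N≡A+2k : N ≡ A + 2 * k
  N≡A+2k = sym (m∸n+n≡m (<⇒≤ 2k<N))
  m≡ : m ≡ 2 * k ∸ ℓ
  m≡ = trans (cong₂ _∸_ N≡A+2k q≡) ([m+n]∸[m+o]≡n∸o A (2 * k) ℓ)
  size : suc (A + l) + m ≡ N
  size = trans (cong (_+ m) (sym q≡1+A+l)) (m+[n∸m]≡n (subst (q ≤_) (sym N≡A+2k) (subst (_≤ A + 2 * k) (sym q≡)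
    (+-monoʳ-≤ A (≤-trans (<⇒≤ ℓ<k) (m≤n*m k 2))))))
  m+1+l≡2k : m + suc l ≡ 2 * k
  m+1+l≡2k = trans (cong (_+ ℓ) m≡) (m∸n+n≡m (≤-trans (<⇒≤ ℓ<k) (m≤n*m k 2)))
  l≤m : l ≤ m
  l≤m = subst (l ≤_) (sym m≡) (m+n≤o⇒m≤o∸n l (begin
    l + ℓ       ≤⟨ +-mono-≤ (<⇒≤ (<-trans (n<1+n l) ℓ<k)) (<⇒≤ ℓ<k) ⟩
    k + k       ≡⟨ cong (k +_) (sym (+-identityʳ k)) ⟩
    2 * k       ∎))

case1 : ∀ {n k q} → 1 ≤ k → 2 * k < suc n → q ≤ suc n ∸ 2 * k → IsF (suc n) k q (k * suc n)
case1 {n} {k} {q} 1≤k 2k<N q≤ with construction-attains {ℓ = 0} 2k<N 1≤k (subst (q ≤_) (sym (+-identityʳ _)) q≤)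
... | G , free , arc , count =
  (G , free , arc , trans (sym (+-identityʳ _)) count) , λ H free (s , _) → Classes.kupitz-bound H s free

case2 : ∀ {n k q} ℓ → 2 * k < suc n → q ≡ suc n ∸ 2 * k + ℓ → 0 < ℓ → ℓ < k →
  IsF (suc n) k q (k * suc n ∸ (ℓ + 1) C 2)
case2 {n} {k} (suc l) 2k<N q≡ _ ℓ<k with construction-attains 2k<N ℓ<k (≤-reflexive q≡)
... | G , free , arc , count =
  (G , free , arc , m+n≡o⇒m≡o∸n (subst (λ t → edgeCount G + t ≡ k * suc n) (triangular[1+ℓ]≡[ℓ+1]C2 (suc l)) count)) ,
  λ H free arc → m+n≤o⇒m≤o∸n (edgeCount H)
    (subst (λ t → edgeCount H + t ≤ k * suc n) (triangular[1+ℓ]≡[ℓ+1]C2 (suc l)) (case2-upper 2k<N ℓ<k q≡ H free arc))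

case3 : ∀ {n k q} → suc n ∸ k ≤ q → q ≤ suc n → IsF (suc n) k q (suc n C 2 ∸ q C 2)
case3 {n} {k} {q} N∸k≤q q≤N = (graph N , graph-IFree N∸k≤q , graph-arc-free , count) , upper
  where
  N : ℕ
  N = suc n
  open Saturated q
  count : edgeCount (graph N) ≡ N C 2 ∸ q C 2
  count = m+n≡o⇒m≡o∸n (subst₂ (λ a b → edgeCount (graph N) + a ≡ b) (triangular≡C2 q) (triangular≡C2 N)
    (subst (λ N → edgeCount (graph N) + triangular q ≡ triangular N) (m+[n∸m]≡n q≤N) (edgeCount-graph (N ∸ q))))
  upper : ∀ H → IFree k H → HasFreeArc H q → edgeCount H ≤ N C 2 ∸ q C 2
  upper H _ (s , arc-free) = subst₂ (λ a b → edgeCount H ≤ a ∸ b) (triangular≡C2 N) (triangular≡C2 q)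
    (FreeArc.complement-bound H s q arc-free)

theorem1 : (n k q : ℕ) → 1 ≤ k → k ≤ ⌊ n /2⌋ ∸ 1 → 1 ≤ q → q ≤ n ∸ 1 →
    (q ≤ n ∸ 2 * k → IsF n k q (k * n))
    × ((ℓ : ℕ) → q ≡ n ∸ 2 * k + ℓ → 0 < ℓ → ℓ < k →
        IsF n k q (k * n ∸ (ℓ + 1) C 2))
    × (n ∸ k ≤ q → IsF n k q (n C 2 ∸ q C 2))
theorem1 zero    k q 1≤k k≤ _ _ with half-bound {0} 1≤k k≤
... | ()
theorem1 (suc n) k q 1≤k k≤ _ q≤n =
  case1 1≤k 2k<n , (λ ℓ q≡ 0<ℓ ℓ<k → case2 ℓ 2k<n q≡ 0<ℓ ℓ<k) , (λ n∸k≤q → case3 n∸k≤q (m≤n⇒m≤1+n q≤n))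
  where
  2k<n : 2 * k < suc n
  2k<n = half-bound 1≤k k≤
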